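{- As formal power series in $q$ (equivalently for $|q|<1$), \[ \sum_{n\geq 1} (-1)^n q^{n^2} = \sum_{n\geq 1} \frac{(-1)^n q^{\frac{n(n+1)}{2}}}{(q;q)_n (1+q^n)}.\]
   Context: The $q$-Pochhammer symbol is $(q;q)_n=\prod_{i=1}^{n}(1-q^i)$. -}

module Defs where

open import Data.Nat as ℕ using (ℕ; zero; suc; _≡ᵇ_)
open import Data.Nat.DivMod using (_/_)
open import Data.Integer using (ℤ; +_; -_; _+_; _*_; 0ℤ; 1ℤ)
open import Data.List using (List; []; _∷_; foldr; map; zipWith; upTo; head)
open import Data.Maybe using (fromMaybe)
open import Data.Bool using (if_then_else_)

sumℤ : List ℤ → ℤ
sumℤ = foldr _+_ 0ℤ

-- Formal power series in q with integer coefficients: n ↦ [q^n] f.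
FPS : Set
FPS = ℕ → ℤ

qpow : ℕ → FPS
qpow m k = if k ≡ᵇ m then 1ℤ else 0ℤ

one : FPS
one = qpow 0

_⊕_ : FPS → FPS → FPS
(f ⊕ g) k = f k + g k

_⊖_ : FPS → FPS → FPS
(f ⊖ g) k = f k + (- g k)

_·_ : ℤ → FPS → FPS
(c · f) k = c * f k

_⊗_ : FPS → FPS → FPS
(f ⊗ g) k = sumℤ (map (λ i → f i * g (k ℕ.∸ i)) (upTo (suc k)))

-- Multiplicative inverse of a series f with constant term f 0 = 1
-- (the only case used below): b_0 = 1, b_k = - Σ_{i=1}^{k} f_i b_{k-i}.
-- invRev f k = [b_k, b_{k-1}, ..., b_0].
invRev : FPS → ℕ → List ℤ
invRev f zero = 1ℤ ∷ []
invRev f (suc k) =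
  let prev = invRev f k
  in (- sumℤ (zipWith _*_ (map (λ i → f (suc i)) (upTo (suc k))) prev)) ∷ prev

inv : FPS → FPS
inv f k = fromMaybe 0ℤ (head (invRev f k))

qPoch : ℕ → FPS
qPoch zero = one
qPoch (suc n) = qPoch n ⊗ (one ⊖ qpow (suc n))

sgn : ℕ → ℤ
sgn zero = 1ℤ
sgn (suc n) = - sgn n

sumTo : ℕ → (ℕ → FPS) → FPS
sumTo zero t = λ _ → 0ℤ
sumTo (suc M) t = sumTo M t ⊕ t (suc M)

lhsTerm : ℕ → FPS
lhsTerm n = sgn n · qpow (n ℕ.* n)

rhsTerm : ℕ → FPS
rhsTerm n = (sgn n · qpow ((n ℕ.* suc n) / 2)) ⊗ inv (qPoch n ⊗ (one ⊕ qpow n))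

module Submission where

-- Both sides are limits of finite identities between polynomials in q; write [M n] for the
-- Gaussian binomial coefficient. On the right, T_M = Σ_{n≤M} (-1)ⁿ q^(n(n+1)/2) wₙ [M n] with
-- w₀ = 1, wₙ = 2/(1+qⁿ) satisfies (1+q^(M+1)) T_(M+1) = (1-q^(M+1)) T_M, because the difference of
-- the summands telescopes to a multiple of Σₙ (-1)ⁿ q^(n(n-1)/2) [M+1 n] = 0; so T_M (-q;q)_M = (q;q)_M.
-- On the left, two Pascal rules give the finite Gauss identity
-- G_M = Σ_{i≤2M} (-1)^(i+M) q^((M-i)²) [2M i] = (q;q²)_M. As (q;q²)_M (-q;q)_M (q;q)_M = (q;q)_(2M),
-- this yields T_M (q;q)_(2M) = G_M (q;q)_M². Modulo q^(M+1) one has [M n] (q;q)_n ≡ 1 and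
-- (q;q)_(2M) ≡ (q;q)_M, so T_M ≡ 1 + 2 Σ_{n=1}^{M} rhsTerm n and G_M (q;q)_M ≡ 1 + 2 Σ_{n=1}^{M} (-1)ⁿ q^(n²).
-- Cancelling (q;q)_M, the two partial sums agree modulo q^(M+1).

open import Defs
open import Data.Nat as ℕ using (ℕ; zero; suc; _≤_; _<_; z≤n; s≤s; _∸_; _≤?_; _≡ᵇ_)
import Data.Nat.Properties as ℕP
open import Data.Nat.DivMod using (_/_; m*n/n≡m)
import Data.Nat.Solver as ℕS
open import Data.Integer as ℤ using (ℤ; -_; _+_; _*_; 0ℤ; 1ℤ; -1ℤ)
import Data.Integer.Properties as ℤP
import Data.Integer.Solver as ℤS
open import Data.List using (List; []; _∷_; map; zipWith; upTo; applyUpTo)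
open import Data.Bool using (false; if_then_else_)
open import Data.Maybe using (Maybe; just; nothing)
open import Data.Product using (∃-syntax; _,_)
open import Function using (_∘_; id)
open import Relation.Nullary using (yes; no)
open import Relation.Binary.PropositionalEquality
import Relation.Binary.Reasoning.Setoid
open import Level using (0ℓ)
open import Algebra.Bundles using (AbelianGroup; CommutativeRing)
open import Algebra.Properties.Group (AbelianGroup.group ℤP.+-0-abelianGroup) using (∙-cancelˡ)
open import Algebra.Structures using (IsCommutativeRing)
open import Algebra.Solver.Ring.AlmostCommutativeRing using (_-Raw-AlmostCommutative⟶_; fromCommutativeRing)

double : ℕ → ℕ
double zero = 0
double (suc n) = suc (suc (double n))

double≡+ : ∀ n → double n ≡ n ℕ.+ n
double≡+ zero = refl
double≡+ (suc n) = cong suc (trans (cong suc (double≡+ n)) (sym (ℕP.+-suc n n)))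

-- triangular n = n(n-1)/2, so that the exponent n(n+1)/2 of rhsTerm is triangular (suc n).
triangular : ℕ → ℕ
triangular zero = 0
triangular (suc n) = triangular n ℕ.+ n

triangular-suc*2 : ∀ n → triangular (suc n) ℕ.* 2 ≡ n ℕ.* suc n
triangular-suc*2 zero = refl
triangular-suc*2 (suc n) = begin
    (triangular (suc n) ℕ.+ suc n) ℕ.* 2      ≡⟨ ℕP.*-distribʳ-+ 2 (triangular (suc n)) (suc n) ⟩
    triangular (suc n) ℕ.* 2 ℕ.+ suc n ℕ.* 2  ≡⟨ cong (ℕ._+ suc n ℕ.* 2) (triangular-suc*2 n) ⟩
    n ℕ.* suc n ℕ.+ suc n ℕ.* 2              ≡⟨ solve 1 (λ n → n :* (con 1 :+ n) :+ (con 1 :+ n) :* con 2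
                                                          := (con 1 :+ n) :* (con 2 :+ n)) refl n ⟩
    suc n ℕ.* suc (suc n)                    ∎
  where open ≡-Reasoning
        open ℕS.+-*-Solver

triangular-suc : ∀ n → (n ℕ.* suc n) / 2 ≡ triangular (suc n)
triangular-suc n = trans (cong (_/ 2) (sym (triangular-suc*2 n))) (m*n/n≡m (triangular (suc n)) 2)

-- With truncated subtraction one of the two summands is 0, so sqDist M i = (M − i)².
sqDist : ℕ → ℕ → ℕ
sqDist M i = (M ∸ i) ℕ.* (M ∸ i) ℕ.+ (i ∸ M) ℕ.* (i ∸ M)

sqDist-+ˡ : ∀ m t → sqDist (m ℕ.+ t) m ≡ t ℕ.* t
sqDist-+ˡ m t rewrite ℕP.m+n∸m≡n m t | ℕP.m≤n⇒m∸n≡0 (ℕP.m≤m+n m t) = ℕP.+-identityʳ (t ℕ.* t)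

sqDist-+ʳ : ∀ M t → sqDist M (M ℕ.+ t) ≡ t ℕ.* t
sqDist-+ʳ M t rewrite ℕP.m+n∸m≡n M t | ℕP.m≤n⇒m∸n≡0 (ℕP.m≤m+n M t) = refl

sqDist-sucˡ : ∀ M m → sqDist (suc M) m ℕ.+ m ℕ.+ m ≡ sqDist M m ℕ.+ suc (double M)
sqDist-sucˡ M m with m ≤? M
... | yes m≤M = subst (λ X → sqDist (suc X) m ℕ.+ m ℕ.+ m ≡ sqDist X m ℕ.+ suc (double X))
                      (ℕP.m+[n∸m]≡n m≤M) (below m (M ∸ m))
  where
    open ℕS.+-*-Solver
    below : ∀ m t → sqDist (suc (m ℕ.+ t)) m ℕ.+ m ℕ.+ m ≡ sqDist (m ℕ.+ t) m ℕ.+ suc (double (m ℕ.+ t))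
    below m t rewrite sym (ℕP.+-suc m t) | sqDist-+ˡ m (suc t) | sqDist-+ˡ m t | double≡+ (m ℕ.+ t) =
      solve 2 (λ m t → (con 1 :+ t) :* (con 1 :+ t) :+ m :+ m
                       := t :* t :+ (con 1 :+ ((m :+ t) :+ (m :+ t)))) refl m t
... | no m≰M = subst (λ Y → sqDist (suc M) Y ℕ.+ Y ℕ.+ Y ≡ sqDist M Y ℕ.+ suc (double M))
                     (ℕP.m+[n∸m]≡n (ℕP.≰⇒> m≰M)) (above M (m ∸ suc M))
  where
    open ℕS.+-*-Solver
    above : ∀ M t → sqDist (suc M) (suc M ℕ.+ t) ℕ.+ (suc M ℕ.+ t) ℕ.+ (suc M ℕ.+ t)
                    ≡ sqDist M (suc M ℕ.+ t) ℕ.+ suc (double M)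
    above M t rewrite sqDist-+ʳ (suc M) t | sym (ℕP.+-suc M t) | sqDist-+ʳ M (suc t) | double≡+ M =
      solve 2 (λ M t → t :* t :+ (M :+ (con 1 :+ t)) :+ (M :+ (con 1 :+ t))
                       := (con 1 :+ t) :* (con 1 :+ t) :+ (con 1 :+ (M :+ M))) refl M t

sqDist-sucʳ : ∀ M m → m ≤ double M → (double M ∸ m) ℕ.+ sqDist M (suc m) ≡ suc m ℕ.+ sqDist M m
sqDist-sucʳ M m m≤2M with suc m ≤? M
... | yes m<M = subst (λ X → (double X ∸ m) ℕ.+ sqDist X (suc m) ≡ suc m ℕ.+ sqDist X m)
                      (ℕP.m+[n∸m]≡n m<M) (below m (M ∸ suc m))
  where
    open ℕS.+-*-Solver
    open ≡-Reasoning
    below : ∀ m t → (double (suc m ℕ.+ t) ∸ m) ℕ.+ sqDist (suc m ℕ.+ t) (suc m)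
                    ≡ suc m ℕ.+ sqDist (suc m ℕ.+ t) m
    below m t = begin
        (double (suc m ℕ.+ t) ∸ m) ℕ.+ sqDist (suc m ℕ.+ t) (suc m)
          ≡⟨ cong₂ ℕ._+_ (trans (cong (_∸ m) (trans (double≡+ (suc m ℕ.+ t))
                 (solve 2 (λ m t → (con 1 :+ m :+ t) :+ (con 1 :+ m :+ t) := m :+ (con 2 :+ t :+ t :+ m)) refl m t)))
                 (ℕP.m+n∸m≡n m _))
               (sqDist-+ˡ (suc m) t) ⟩
        suc (suc (t ℕ.+ t ℕ.+ m)) ℕ.+ t ℕ.* t
          ≡⟨ solve 2 (λ m t → (con 2 :+ t :+ t :+ m) :+ t :* t := (con 1 :+ m) :+ (con 1 :+ t) :* (con 1 :+ t)) refl m t ⟩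
        suc m ℕ.+ suc t ℕ.* suc t
          ≡⟨ cong (suc m ℕ.+_) (sym (trans (cong (λ X → sqDist X m) (sym (ℕP.+-suc m t))) (sqDist-+ˡ m (suc t)))) ⟩
        suc m ℕ.+ sqDist (suc m ℕ.+ t) m ∎
... | no m≮M = subst₂ (λ X Y → (double X ∸ Y) ℕ.+ sqDist X (suc Y) ≡ suc Y ℕ.+ sqDist X Y)
                      t+r≡M t+r+t≡m (above t r)
  where
    open ℕS.+-*-Solver
    open ≡-Reasoning
    above : ∀ t r → (double (t ℕ.+ r) ∸ ((t ℕ.+ r) ℕ.+ t)) ℕ.+ sqDist (t ℕ.+ r) (suc ((t ℕ.+ r) ℕ.+ t))
                    ≡ suc ((t ℕ.+ r) ℕ.+ t) ℕ.+ sqDist (t ℕ.+ r) ((t ℕ.+ r) ℕ.+ t)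
    above t r = begin
        (double (t ℕ.+ r) ∸ ((t ℕ.+ r) ℕ.+ t)) ℕ.+ sqDist (t ℕ.+ r) (suc ((t ℕ.+ r) ℕ.+ t))
          ≡⟨ cong₂ ℕ._+_ (trans (cong (_∸ ((t ℕ.+ r) ℕ.+ t)) (trans (double≡+ (t ℕ.+ r))
                 (solve 2 (λ t r → (t :+ r) :+ (t :+ r) := ((t :+ r) :+ t) :+ r) refl t r)))
                 (ℕP.m+n∸m≡n ((t ℕ.+ r) ℕ.+ t) r))
               (trans (cong (sqDist (t ℕ.+ r)) (sym (ℕP.+-suc (t ℕ.+ r) t))) (sqDist-+ʳ (t ℕ.+ r) (suc t))) ⟩
        r ℕ.+ suc t ℕ.* suc t
          ≡⟨ solve 2 (λ t r → r :+ (con 1 :+ t) :* (con 1 :+ t) := (con 1 :+ ((t :+ r) :+ t)) :+ t :* t) refl t r ⟩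
        suc ((t ℕ.+ r) ℕ.+ t) ℕ.+ t ℕ.* t
          ≡⟨ cong (suc ((t ℕ.+ r) ℕ.+ t) ℕ.+_) (sym (sqDist-+ʳ (t ℕ.+ r) t)) ⟩
        suc ((t ℕ.+ r) ℕ.+ t) ℕ.+ sqDist (t ℕ.+ r) ((t ℕ.+ r) ℕ.+ t) ∎
    M≤m : M ≤ m
    M≤m = ℕP.≤-pred (ℕP.≰⇒> m≮M)
    t = m ∸ M
    M+t≡m : M ℕ.+ t ≡ m
    M+t≡m = ℕP.m+[n∸m]≡n M≤m
    t≤M : t ≤ M
    t≤M = ℕP.+-cancelˡ-≤ M t M (subst₂ _≤_ (sym M+t≡m) (double≡+ M) m≤2M)
    r = M ∸ t
    t+r≡M : t ℕ.+ r ≡ M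
    t+r≡M = ℕP.m+[n∸m]≡n t≤M
    t+r+t≡m : (t ℕ.+ r) ℕ.+ t ≡ m
    t+r+t≡m = trans (cong (ℕ._+ t) t+r≡M) M+t≡m

sgn-double+ : ∀ k n → sgn (double k ℕ.+ n) ≡ sgn n
sgn-double+ zero n = refl
sgn-double+ (suc k) n = trans (ℤP.neg-involutive (sgn (double k ℕ.+ n))) (sgn-double+ k n)

infix 4 _≐_
_≐_ : FPS → FPS → Set
f ≐ g = ∀ k → f k ≡ g k

zeroF : FPS
zeroF _ = 0ℤ

negF : FPS → FPS
negF f k = - f k

shift : FPS → FPS
shift f = f ∘ suc

map-applyUpTo : ∀ (φ : ℕ → ℤ) (f : ℕ → ℕ) n → map φ (applyUpTo f n) ≡ applyUpTo (φ ∘ f) n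
map-applyUpTo φ f zero = refl
map-applyUpTo φ f (suc n) = cong (φ (f 0) ∷_) (map-applyUpTo φ (f ∘ suc) n)

sumℤ-map-cong : ∀ {φ ψ : ℕ → ℤ} (xs : List ℕ) → (∀ i → φ i ≡ ψ i) → sumℤ (map φ xs) ≡ sumℤ (map ψ xs)
sumℤ-map-cong [] _ = refl
sumℤ-map-cong (x ∷ xs) e = cong₂ _+_ (e x) (sumℤ-map-cong xs e)

⊗-coeff-zero : ∀ f g → (f ⊗ g) 0 ≡ f 0 * g 0
⊗-coeff-zero f g = ℤP.+-identityʳ _

⊗-coeff-sucˡ : ∀ f g k → (f ⊗ g) (suc k) ≡ f 0 * g (suc k) + (shift f ⊗ g) k
⊗-coeff-sucˡ f g k = cong (λ xs → f 0 * g (suc k) + sumℤ xs)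
  (trans (map-applyUpTo (λ i → f i * g (suc k ∸ i)) suc (suc k))
         (sym (map-applyUpTo (λ i → f (suc i) * g (k ∸ i)) id (suc k))))

⊗-coeff-sucʳ : ∀ f g k → (f ⊗ g) (suc k) ≡ f (suc k) * g 0 + (f ⊗ shift g) k
⊗-coeff-sucʳ f g zero = begin
    (f ⊗ g) 1                       ≡⟨ ⊗-coeff-sucˡ f g 0 ⟩
    f 0 * g 1 + (shift f ⊗ g) 0     ≡⟨ cong (λ x → f 0 * g 1 + x) (⊗-coeff-zero (shift f) g) ⟩
    f 0 * g 1 + f 1 * g 0           ≡⟨ ℤP.+-comm (f 0 * g 1) (f 1 * g 0) ⟩
    f 1 * g 0 + f 0 * g 1           ≡⟨ cong (λ x → f 1 * g 0 + x) (sym (⊗-coeff-zero f (shift g))) ⟩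
    f 1 * g 0 + (f ⊗ shift g) 0     ∎
  where open ≡-Reasoning
⊗-coeff-sucʳ f g (suc k) = begin
    (f ⊗ g) (suc (suc k))
      ≡⟨ ⊗-coeff-sucˡ f g (suc k) ⟩
    f 0 * g (suc (suc k)) + (shift f ⊗ g) (suc k)
      ≡⟨ cong (λ x → f 0 * g (suc (suc k)) + x) (⊗-coeff-sucʳ (shift f) g k) ⟩
    f 0 * g (suc (suc k)) + (f (suc (suc k)) * g 0 + (shift f ⊗ shift g) k)
      ≡⟨ solve 3 (λ a b c → a :+ (b :+ c) := b :+ (a :+ c)) refl
           (f 0 * g (suc (suc k))) (f (suc (suc k)) * g 0) ((shift f ⊗ shift g) k) ⟩
    f (suc (suc k)) * g 0 + (f 0 * g (suc (suc k)) + (shift f ⊗ shift g) k)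
      ≡⟨ cong (λ x → f (suc (suc k)) * g 0 + x) (sym (⊗-coeff-sucˡ f (shift g) k)) ⟩
    f (suc (suc k)) * g 0 + (f ⊗ shift g) (suc k) ∎
  where open ≡-Reasoning
        open ℤS.+-*-Solver

⊗-cong-≐ : ∀ {f f′ g g′} → f ≐ f′ → g ≐ g′ → f ⊗ g ≐ f′ ⊗ g′
⊗-cong-≐ ef eg k = sumℤ-map-cong (upTo (suc k)) (λ i → cong₂ _*_ (ef i) (eg (k ∸ i)))

⊗-comm-≐ : ∀ f g → f ⊗ g ≐ g ⊗ f
⊗-comm-≐ f g zero = trans (⊗-coeff-zero f g) (trans (ℤP.*-comm (f 0) (g 0)) (sym (⊗-coeff-zero g f)))
⊗-comm-≐ f g (suc k) = begin
    (f ⊗ g) (suc k)                      ≡⟨ ⊗-coeff-sucˡ f g k ⟩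
    f 0 * g (suc k) + (shift f ⊗ g) k    ≡⟨ cong₂ _+_ (ℤP.*-comm (f 0) (g (suc k))) (⊗-comm-≐ (shift f) g k) ⟩
    g (suc k) * f 0 + (g ⊗ shift f) k    ≡⟨ sym (⊗-coeff-sucʳ g f k) ⟩
    (g ⊗ f) (suc k)                      ∎
  where open ≡-Reasoning

⊗-distribʳ-≐ : ∀ f g h → (f ⊕ g) ⊗ h ≐ (f ⊗ h) ⊕ (g ⊗ h)
⊗-distribʳ-≐ f g h zero = begin
    ((f ⊕ g) ⊗ h) 0            ≡⟨ ⊗-coeff-zero (f ⊕ g) h ⟩
    (f 0 + g 0) * h 0          ≡⟨ ℤP.*-distribʳ-+ (h 0) (f 0) (g 0) ⟩
    f 0 * h 0 + g 0 * h 0      ≡⟨ sym (cong₂ _+_ (⊗-coeff-zero f h) (⊗-coeff-zero g h)) ⟩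
    (f ⊗ h) 0 + (g ⊗ h) 0      ∎
  where open ≡-Reasoning
⊗-distribʳ-≐ f g h (suc k) = begin
    ((f ⊕ g) ⊗ h) (suc k)
      ≡⟨ ⊗-coeff-sucˡ (f ⊕ g) h k ⟩
    (f 0 + g 0) * h (suc k) + (shift (f ⊕ g) ⊗ h) k
      ≡⟨ cong (λ x → (f 0 + g 0) * h (suc k) + x) (⊗-distribʳ-≐ (shift f) (shift g) h k) ⟩
    (f 0 + g 0) * h (suc k) + ((shift f ⊗ h) k + (shift g ⊗ h) k)
      ≡⟨ solve 5 (λ a b c x y → (a :+ b) :* c :+ (x :+ y) := (a :* c :+ x) :+ (b :* c :+ y)) refl
           (f 0) (g 0) (h (suc k)) ((shift f ⊗ h) k) ((shift g ⊗ h) k) ⟩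
    (f 0 * h (suc k) + (shift f ⊗ h) k) + (g 0 * h (suc k) + (shift g ⊗ h) k)
      ≡⟨ sym (cong₂ _+_ (⊗-coeff-sucˡ f h k) (⊗-coeff-sucˡ g h k)) ⟩
    (f ⊗ h) (suc k) + (g ⊗ h) (suc k) ∎
  where open ≡-Reasoning
        open ℤS.+-*-Solver

·-⊗-assoc-≐ : ∀ c f g → (c · f) ⊗ g ≐ c · (f ⊗ g)
·-⊗-assoc-≐ c f g zero =
  trans (⊗-coeff-zero (c · f) g) (trans (ℤP.*-assoc c (f 0) (g 0)) (cong (c *_) (sym (⊗-coeff-zero f g))))
·-⊗-assoc-≐ c f g (suc k) = begin
    ((c · f) ⊗ g) (suc k)
      ≡⟨ ⊗-coeff-sucˡ (c · f) g k ⟩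
    c * f 0 * g (suc k) + (shift (c · f) ⊗ g) k
      ≡⟨ cong (λ x → c * f 0 * g (suc k) + x) (·-⊗-assoc-≐ c (shift f) g k) ⟩
    c * f 0 * g (suc k) + c * (shift f ⊗ g) k
      ≡⟨ solve 4 (λ c a b x → c :* a :* b :+ c :* x := c :* (a :* b :+ x)) refl c (f 0) (g (suc k)) ((shift f ⊗ g) k) ⟩
    c * (f 0 * g (suc k) + (shift f ⊗ g) k)
      ≡⟨ cong (c *_) (sym (⊗-coeff-sucˡ f g k)) ⟩
    c * (f ⊗ g) (suc k) ∎
  where open ≡-Reasoning
        open ℤS.+-*-Solver

⊗-assoc-≐ : ∀ f g h → (f ⊗ g) ⊗ h ≐ f ⊗ (g ⊗ h)
⊗-assoc-≐ f g h zero = begin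
    ((f ⊗ g) ⊗ h) 0      ≡⟨ ⊗-coeff-zero (f ⊗ g) h ⟩
    (f ⊗ g) 0 * h 0      ≡⟨ cong (_* h 0) (⊗-coeff-zero f g) ⟩
    f 0 * g 0 * h 0      ≡⟨ ℤP.*-assoc (f 0) (g 0) (h 0) ⟩
    f 0 * (g 0 * h 0)    ≡⟨ cong (f 0 *_) (sym (⊗-coeff-zero g h)) ⟩
    f 0 * (g ⊗ h) 0      ≡⟨ sym (⊗-coeff-zero f (g ⊗ h)) ⟩
    (f ⊗ (g ⊗ h)) 0      ∎
  where open ≡-Reasoning
⊗-assoc-≐ f g h (suc k) = begin
    ((f ⊗ g) ⊗ h) (suc k)
      ≡⟨ ⊗-coeff-sucˡ (f ⊗ g) h k ⟩
    (f ⊗ g) 0 * h (suc k) + (shift (f ⊗ g) ⊗ h) k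
      ≡⟨ cong₂ (λ a b → a * h (suc k) + b) (⊗-coeff-zero f g) (⊗-cong-≐ {g = h} (⊗-coeff-sucˡ f g) (λ _ → refl) k) ⟩
    f 0 * g 0 * h (suc k) + (((f 0 · shift g) ⊕ (shift f ⊗ g)) ⊗ h) k
      ≡⟨ cong (λ x → f 0 * g 0 * h (suc k) + x) (⊗-distribʳ-≐ (f 0 · shift g) (shift f ⊗ g) h k) ⟩
    f 0 * g 0 * h (suc k) + (((f 0 · shift g) ⊗ h) k + ((shift f ⊗ g) ⊗ h) k)
      ≡⟨ cong₂ (λ a b → f 0 * g 0 * h (suc k) + (a + b)) (·-⊗-assoc-≐ (f 0) (shift g) h k) (⊗-assoc-≐ (shift f) g h k) ⟩
    f 0 * g 0 * h (suc k) + (f 0 * (shift g ⊗ h) k + (shift f ⊗ (g ⊗ h)) k)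
      ≡⟨ solve 5 (λ a b c x y → a :* b :* c :+ (a :* x :+ y) := a :* (b :* c :+ x) :+ y) refl
           (f 0) (g 0) (h (suc k)) ((shift g ⊗ h) k) ((shift f ⊗ (g ⊗ h)) k) ⟩
    f 0 * (g 0 * h (suc k) + (shift g ⊗ h) k) + (shift f ⊗ (g ⊗ h)) k
      ≡⟨ cong (λ a → f 0 * a + (shift f ⊗ (g ⊗ h)) k) (sym (⊗-coeff-sucˡ g h k)) ⟩
    f 0 * (g ⊗ h) (suc k) + (shift f ⊗ (g ⊗ h)) k
      ≡⟨ sym (⊗-coeff-sucˡ f (g ⊗ h) k) ⟩
    (f ⊗ (g ⊗ h)) (suc k) ∎
  where open ≡-Reasoning
        open ℤS.+-*-Solver

⊗-zeroˡ-≐ : ∀ g → zeroF ⊗ g ≐ zeroF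
⊗-zeroˡ-≐ g zero = ⊗-coeff-zero zeroF g
⊗-zeroˡ-≐ g (suc k) = trans (⊗-coeff-sucˡ zeroF g k) (cong (λ x → 0ℤ * g (suc k) + x) (⊗-zeroˡ-≐ g k))

⊗-identityˡ-≐ : ∀ g → one ⊗ g ≐ g
⊗-identityˡ-≐ g zero = trans (⊗-coeff-zero one g) (ℤP.*-identityˡ (g 0))
⊗-identityˡ-≐ g (suc k) = begin
    (one ⊗ g) (suc k)                  ≡⟨ ⊗-coeff-sucˡ one g k ⟩
    1ℤ * g (suc k) + (zeroF ⊗ g) k     ≡⟨ cong (λ x → 1ℤ * g (suc k) + x) (⊗-zeroˡ-≐ g k) ⟩
    1ℤ * g (suc k) + 0ℤ                ≡⟨ ℤP.+-identityʳ _ ⟩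
    1ℤ * g (suc k)                     ≡⟨ ℤP.*-identityˡ (g (suc k)) ⟩
    g (suc k)                          ∎
  where open ≡-Reasoning

-- A record rather than ∀ k → f k ≡ g k, so that f and g can be inferred from f ≈ g.
infix 4 _≈_
record _≈_ (f g : FPS) : Set where
  constructor mk≈
  field coeff : f ≐ g
open _≈_

FPS-isCommutativeRing : IsCommutativeRing _≈_ _⊕_ _⊗_ negF zeroF one
FPS-isCommutativeRing = record
  { isRing = record
    { +-isAbelianGroup = record
      { isGroup = record
        { isMonoid = record
          { isSemigroup = record
            { isMagma = record
              { isEquivalence = record
                { refl = mk≈ (λ _ → refl)
                ; sym = λ e → mk≈ (λ k → sym (coeff e k))
                ; trans = λ e e′ → mk≈ (λ k → trans (coeff e k) (coeff e′ k)) }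
              ; ∙-cong = λ e e′ → mk≈ (λ k → cong₂ _+_ (coeff e k) (coeff e′ k)) }
            ; assoc = λ f g h → mk≈ (λ k → ℤP.+-assoc (f k) (g k) (h k)) }
          ; identity = (λ f → mk≈ (λ k → ℤP.+-identityˡ (f k))) , (λ f → mk≈ (λ k → ℤP.+-identityʳ (f k))) }
        ; inverse = (λ f → mk≈ (λ k → ℤP.+-inverseˡ (f k))) , (λ f → mk≈ (λ k → ℤP.+-inverseʳ (f k)))
        ; ⁻¹-cong = λ e → mk≈ (λ k → cong -_ (coeff e k)) }
      ; comm = λ f g → mk≈ (λ k → ℤP.+-comm (f k) (g k)) }
    ; *-cong = λ e e′ → mk≈ (⊗-cong-≐ (coeff e) (coeff e′))
    ; *-assoc = λ f g h → mk≈ (⊗-assoc-≐ f g h)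
    ; *-identity = (λ g → mk≈ (⊗-identityˡ-≐ g))
                 , (λ g → mk≈ (λ k → trans (⊗-comm-≐ g one k) (⊗-identityˡ-≐ g k)))
    ; distrib = (λ f g h → mk≈ (λ k → trans (⊗-comm-≐ f (g ⊕ h) k)
                                    (trans (⊗-distribʳ-≐ g h f k) (cong₂ _+_ (⊗-comm-≐ g f k) (⊗-comm-≐ h f k)))))
              , (λ h f g → mk≈ (⊗-distribʳ-≐ f g h)) }
  ; *-comm = λ f g → mk≈ (⊗-comm-≐ f g) }

FPS-commutativeRing : CommutativeRing 0ℓ 0ℓ
FPS-commutativeRing = record { isCommutativeRing = FPS-isCommutativeRing }

open CommutativeRing FPS-commutativeRing public
  using (*-assoc; *-comm; *-identityˡ; *-identityʳ; zeroʳ; +-cong; *-cong; -‿cong)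
  renaming (refl to ≈-refl; sym to ≈-sym; trans to ≈-trans; setoid to FPS-setoid)

⊕-congˡ : ∀ c {a b} → a ≈ b → c ⊕ a ≈ c ⊕ b
⊕-congˡ c a≈b = +-cong (≈-refl {c}) a≈b

⊕-congʳ : ∀ c {a b} → a ≈ b → a ⊕ c ≈ b ⊕ c
⊕-congʳ c a≈b = +-cong a≈b (≈-refl {c})

⊗-congˡ : ∀ c {a b} → a ≈ b → c ⊗ a ≈ c ⊗ b
⊗-congˡ c a≈b = *-cong (≈-refl {c}) a≈b

⊗-congʳ : ∀ c {a b} → a ≈ b → a ⊗ c ≈ b ⊗ c
⊗-congʳ c a≈b = *-cong a≈b (≈-refl {c})

const : ℤ → FPS
const c k = if k ≡ᵇ 0 then c else 0ℤ

const-⊗ : ∀ a g → const a ⊗ g ≐ a · g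
const-⊗ a g zero = ⊗-coeff-zero (const a) g
const-⊗ a g (suc k) =
  trans (⊗-coeff-sucˡ (const a) g k) (trans (cong (λ x → a * g (suc k) + x) (⊗-zeroˡ-≐ g k)) (ℤP.+-identityʳ _))

const-morphism : CommutativeRing.rawRing ℤP.+-*-commutativeRing -Raw-AlmostCommutative⟶ fromCommutativeRing FPS-commutativeRing
const-morphism = record
  { ⟦_⟧ = const
  ; +-homo = λ a b → mk≈ λ { zero → refl ; (suc k) → refl }
  ; *-homo = λ a b → mk≈ λ k → trans (*-homo a b k) (sym (const-⊗ a (const b) k))
  ; -‿homo = λ a → mk≈ λ { zero → refl ; (suc k) → refl }
  ; 0-homo = mk≈ λ { zero → refl ; (suc k) → refl }
  ; 1-homo = mk≈ λ _ → refl
  }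
  where
    *-homo : ∀ a b k → const (a * b) k ≡ a * const b k
    *-homo a b zero = refl
    *-homo a b (suc k) = sym (ℤP.*-zeroʳ a)

const-≟ : ∀ a b → Maybe (const a ≈ const b)
const-≟ a b with a ℤP.≟ b
... | yes refl = just (mk≈ λ _ → refl)
... | no _ = nothing

open import Algebra.Solver.Ring (CommutativeRing.rawRing ℤP.+-*-commutativeRing)
  (fromCommutativeRing FPS-commutativeRing) const-morphism const-≟ public

module ≈-Reasoning = Relation.Binary.Reasoning.Setoid FPS-setoid

invRev≡map-inv : ∀ f k → invRev f k ≡ map (λ i → inv f (k ∸ i)) (upTo (suc k))
invRev≡map-inv f zero = refl
invRev≡map-inv f (suc k) = cong (inv f (suc k) ∷_) (begin
    invRev f k                                            ≡⟨ invRev≡map-inv f k ⟩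
    map (λ i → inv f (k ∸ i)) (upTo (suc k))              ≡⟨ map-applyUpTo (λ i → inv f (k ∸ i)) id (suc k) ⟩
    applyUpTo (λ i → inv f (k ∸ i)) (suc k)               ≡⟨ sym (map-applyUpTo (λ i → inv f (suc k ∸ i)) suc (suc k)) ⟩
    map (λ i → inv f (suc k ∸ i)) (applyUpTo suc (suc k)) ∎)
  where open ≡-Reasoning

zipWith-*-map : ∀ (a b : ℕ → ℤ) xs → zipWith _*_ (map a xs) (map b xs) ≡ map (λ i → a i * b i) xs
zipWith-*-map a b [] = refl
zipWith-*-map a b (x ∷ xs) = cong (a x * b x ∷_) (zipWith-*-map a b xs)

inv-suc : ∀ f k → inv f (suc k) ≡ - (shift f ⊗ inv f) k
inv-suc f k = cong (λ xs → - sumℤ xs)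
  (trans (cong (zipWith _*_ (map (λ i → f (suc i)) (upTo (suc k)))) (invRev≡map-inv f k))
         (zipWith-*-map (λ i → f (suc i)) (λ i → inv f (k ∸ i)) (upTo (suc k))))

⊗-inverseʳ : ∀ f → f 0 ≡ 1ℤ → f ⊗ inv f ≈ one
⊗-inverseʳ f f0≡1 = mk≈ λ
  { zero → trans (⊗-coeff-zero f (inv f)) (cong (_* 1ℤ) f0≡1)
  ; (suc k) → begin
      (f ⊗ inv f) (suc k)                           ≡⟨ ⊗-coeff-sucˡ f (inv f) k ⟩
      f 0 * inv f (suc k) + (shift f ⊗ inv f) k     ≡⟨ cong₂ (λ a b → a * b + (shift f ⊗ inv f) k) f0≡1 (inv-suc f k) ⟩
      1ℤ * - (shift f ⊗ inv f) k + (shift f ⊗ inv f) k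
        ≡⟨ cong (_+ (shift f ⊗ inv f) k) (ℤP.*-identityˡ (- (shift f ⊗ inv f) k)) ⟩
      - (shift f ⊗ inv f) k + (shift f ⊗ inv f) k   ≡⟨ ℤP.+-inverseˡ ((shift f ⊗ inv f) k) ⟩
      0ℤ                                            ∎ }
  where open ≡-Reasoning

⊗-inverse-cancelʳ : ∀ f c → c 0 ≡ 1ℤ → (f ⊗ c) ⊗ inv c ≈ f
⊗-inverse-cancelʳ f c c0≡1 = ≈-trans (*-assoc f c (inv c)) (≈-trans (⊗-congˡ f (⊗-inverseʳ c c0≡1)) (*-identityʳ f))

-- Congruence modulo powers of q

⊗-coeff-cong : ∀ j {f f′ g g′} → (∀ i → i ≤ j → f i ≡ f′ i) → (∀ i → i ≤ j → g i ≡ g′ i) →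
               (f ⊗ g) j ≡ (f′ ⊗ g′) j
⊗-coeff-cong zero {f} {f′} {g} {g′} ef eg =
  trans (⊗-coeff-zero f g) (trans (cong₂ _*_ (ef 0 z≤n) (eg 0 z≤n)) (sym (⊗-coeff-zero f′ g′)))
⊗-coeff-cong (suc j) {f} {f′} {g} {g′} ef eg = trans (⊗-coeff-sucˡ f g j) (trans
  (cong₂ _+_ (cong₂ _*_ (ef 0 z≤n) (eg (suc j) ℕP.≤-refl))
             (⊗-coeff-cong j {shift f} {shift f′} (λ i i≤j → ef (suc i) (s≤s i≤j)) (λ i i≤j → eg i (ℕP.m≤n⇒m≤1+n i≤j))))
  (sym (⊗-coeff-sucˡ f′ g′ j)))

infix 4 _≡[_]_
_≡[_]_ : FPS → ℕ → FPS → Set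
f ≡[ K ] g = ∀ j → j < K → f j ≡ g j

≈⇒≡[] : ∀ {f g} K → f ≈ g → f ≡[ K ] g
≈⇒≡[] K e j _ = coeff e j

≡[]-refl : ∀ {f K} → f ≡[ K ] f
≡[]-refl _ _ = refl

≡[]-sym : ∀ {f g K} → f ≡[ K ] g → g ≡[ K ] f
≡[]-sym e j j<K = sym (e j j<K)

≡[]-trans : ∀ {f g h K} → f ≡[ K ] g → g ≡[ K ] h → f ≡[ K ] h
≡[]-trans e e′ j j<K = trans (e j j<K) (e′ j j<K)

≡[]-weaken : ∀ {f g K L} → L ≤ K → f ≡[ K ] g → f ≡[ L ] g
≡[]-weaken L≤K e j j<L = e j (ℕP.<-≤-trans j<L L≤K)

⊕-≡[] : ∀ {f f′ g g′ K} → f ≡[ K ] f′ → g ≡[ K ] g′ → f ⊕ g ≡[ K ] f′ ⊕ g′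
⊕-≡[] ef eg j j<K = cong₂ _+_ (ef j j<K) (eg j j<K)

⊗-≡[] : ∀ {f f′ g g′ K} → f ≡[ K ] f′ → g ≡[ K ] g′ → f ⊗ g ≡[ K ] f′ ⊗ g′
⊗-≡[] ef eg j j<K = ⊗-coeff-cong j (λ i i≤j → ef i (ℕP.≤-<-trans i≤j j<K)) (λ i i≤j → eg i (ℕP.≤-<-trans i≤j j<K))

⊗-cancelʳ-≡[] : ∀ {f g c K} → c 0 ≡ 1ℤ → f ⊗ c ≡[ K ] g ⊗ c → f ≡[ K ] g
⊗-cancelʳ-≡[] {f} {g} {c} {K} c0≡1 e =
  ≡[]-trans (≈⇒≡[] K (≈-sym (⊗-inverse-cancelʳ f c c0≡1)))
  (≡[]-trans (⊗-≡[] {g = inv c} e ≡[]-refl) (≈⇒≡[] K (⊗-inverse-cancelʳ g c c0≡1)))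

infix 4 q^_∣_
q^_∣_ : ℕ → FPS → Set
q^ a ∣ f = f ≡[ a ] zeroF

q^∣-⊗ˡ : ∀ b f g → q^ b ∣ g → q^ b ∣ f ⊗ g
q^∣-⊗ˡ b f g qᵇ∣g zero 0<b =
  trans (⊗-coeff-zero f g) (trans (cong (f 0 *_) (qᵇ∣g 0 0<b)) (ℤP.*-zeroʳ (f 0)))
q^∣-⊗ˡ b f g qᵇ∣g (suc j) j<b = trans (⊗-coeff-sucˡ f g j)
  (trans (cong₂ _+_ (cong (f 0 *_) (qᵇ∣g (suc j) j<b)) (q^∣-⊗ˡ b (shift f) g qᵇ∣g j (ℕP.<-trans (ℕP.n<1+n j) j<b)))
         (cong (_+ 0ℤ) (ℤP.*-zeroʳ (f 0))))

q^∣-⊗ : ∀ a b f g → q^ a ∣ f → q^ b ∣ g → q^ (a ℕ.+ b) ∣ f ⊗ g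
q^∣-⊗ zero b f g _ qᵇ∣g = q^∣-⊗ˡ b f g qᵇ∣g
q^∣-⊗ (suc a) b f g qᵃ∣f qᵇ∣g zero _ = trans (⊗-coeff-zero f g) (cong (_* g 0) (qᵃ∣f 0 (s≤s z≤n)))
q^∣-⊗ (suc a) b f g qᵃ∣f qᵇ∣g (suc j) (s≤s j<a+b) = trans (⊗-coeff-sucˡ f g j)
  (cong₂ _+_ (cong (_* g (suc j)) (qᵃ∣f 0 (s≤s z≤n)))
             (q^∣-⊗ a b (shift f) g (λ i i<a → qᵃ∣f (suc i) (s≤s i<a)) qᵇ∣g j j<a+b))

<⇒≡ᵇ-false : ∀ j a → j < a → (j ≡ᵇ a) ≡ false
<⇒≡ᵇ-false zero (suc a) _ = refl
<⇒≡ᵇ-false (suc j) (suc a) (s≤s j<a) = <⇒≡ᵇ-false j a j<a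

q^∣qpow : ∀ a → q^ a ∣ qpow a
q^∣qpow a j j<a rewrite <⇒≡ᵇ-false j a j<a = refl

q^∣⊖⇒≡[] : ∀ {f g K} → q^ K ∣ f ⊖ g → f ≡[ K ] g
q^∣⊖⇒≡[] {f} {g} qᴷ∣f⊖g j j<K = begin
    f j                  ≡⟨ sym (ℤP.+-identityʳ (f j)) ⟩
    f j + 0ℤ             ≡⟨ cong (f j +_) (sym (ℤP.+-inverseˡ (g j))) ⟩
    f j + (- g j + g j)  ≡⟨ sym (ℤP.+-assoc (f j) (- g j) (g j)) ⟩
    (f j + - g j) + g j  ≡⟨ cong (_+ g j) (qᴷ∣f⊖g j j<K) ⟩
    0ℤ + g j             ≡⟨ ℤP.+-identityˡ (g j) ⟩
    g j                  ∎
  where open ≡-Reasoning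

≡[]⇒q^∣⊖ : ∀ {f g K} → f ≡[ K ] g → q^ K ∣ f ⊖ g
≡[]⇒q^∣⊖ {f} {g} e j j<K = trans (cong (_+ - g j) (e j j<K)) (ℤP.+-inverseʳ (g j))

⊗-≡[]-q^∣ : ∀ {a K A f g} → q^ a ∣ A → f ≡[ K ∸ a ] g → A ⊗ f ≡[ K ] A ⊗ g
⊗-≡[]-q^∣ {a} {K} {A} {f} {g} qᵃ∣A e = q^∣⊖⇒≡[] {A ⊗ f} {A ⊗ g}
  (≡[]-weaken (ℕP.m≤n+m∸n K a) (λ j j<K → trans (coeff factor j)
     (q^∣-⊗ a (K ∸ a) A (f ⊖ g) qᵃ∣A (≡[]⇒q^∣⊖ e) j j<K)))
  where
    factor : (A ⊗ f) ⊖ (A ⊗ g) ≈ A ⊗ (f ⊖ g)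
    factor = solve 3 (λ A f g → (A :* f) :- (A :* g) := A :* (f :- g)) ≈-refl A f g

qpow-+ : ∀ a b → qpow a ⊗ qpow b ≈ qpow (a ℕ.+ b)
qpow-+ a b = mk≈ (go a b)
  where
    go : ∀ a b → qpow a ⊗ qpow b ≐ qpow (a ℕ.+ b)
    go zero b = ⊗-identityˡ-≐ (qpow b)
    go (suc a) b zero = ⊗-coeff-zero (qpow (suc a)) (qpow b)
    go (suc a) b (suc k) = trans (⊗-coeff-sucˡ (qpow (suc a)) (qpow b) k) (trans (ℤP.+-identityˡ _) (go a b k))

qpow-+≡ : ∀ a b {c} → a ℕ.+ b ≡ c → qpow a ⊗ qpow b ≈ qpow c
qpow-+≡ a b refl = qpow-+ a b

qpow-cong : ∀ {a b} → a ≡ b → qpow a ≈ qpow b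
qpow-cong refl = ≈-refl

const-cong : ∀ {a b} → a ≡ b → const a ≈ const b
const-cong refl = ≈-refl

Σ< : ℕ → (ℕ → FPS) → FPS
Σ< zero f = zeroF
Σ< (suc L) f = Σ< L f ⊕ f L

Σ<-cong : ∀ L {f g} → (∀ i → i < L → f i ≈ g i) → Σ< L f ≈ Σ< L g
Σ<-cong zero e = ≈-refl
Σ<-cong (suc L) e = +-cong (Σ<-cong L (λ i i<L → e i (ℕP.m≤n⇒m≤1+n i<L))) (e L ℕP.≤-refl)

Σ<-≡[] : ∀ L {f g K} → (∀ i → i < L → f i ≡[ K ] g i) → Σ< L f ≡[ K ] Σ< L g
Σ<-≡[] zero e = ≡[]-refl
Σ<-≡[] (suc L) e = ⊕-≡[] (Σ<-≡[] L (λ i i<L → e i (ℕP.m≤n⇒m≤1+n i<L))) (e L ℕP.≤-refl)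

Σ<-⊕ : ∀ L (f g : ℕ → FPS) → Σ< L (λ i → f i ⊕ g i) ≈ Σ< L f ⊕ Σ< L g
Σ<-⊕ zero f g = mk≈ λ _ → sym (ℤP.+-identityʳ 0ℤ)
Σ<-⊕ (suc L) f g = ≈-trans (⊕-congʳ (f L ⊕ g L) (Σ<-⊕ L f g))
  (solve 4 (λ a b c d → (a :+ b) :+ (c :+ d) := (a :+ c) :+ (b :+ d)) ≈-refl (Σ< L f) (Σ< L g) (f L) (g L))

⊗-Σ< : ∀ L c (f : ℕ → FPS) → c ⊗ Σ< L f ≈ Σ< L (λ i → c ⊗ f i)
⊗-Σ< zero c f = zeroʳ c
⊗-Σ< (suc L) c f = ≈-trans (CommutativeRing.distribˡ FPS-commutativeRing c (Σ< L f) (f L)) (⊕-congʳ (c ⊗ f L) (⊗-Σ< L c f))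

Σ<-⊖ : ∀ L (f g : ℕ → FPS) → Σ< L (λ i → f i ⊖ g i) ≈ Σ< L f ⊖ Σ< L g
Σ<-⊖ L f g = ≈-trans (Σ<-⊕ L f (negF ∘ g)) (⊕-congˡ (Σ< L f) (≈-sym (Σ<-negF L)))
  where
    Σ<-negF : ∀ L → negF (Σ< L g) ≈ Σ< L (negF ∘ g)
    Σ<-negF zero = ≈-refl
    Σ<-negF (suc L) = ≈-trans (solve 2 (λ a b → :- (a :+ b) := :- a :+ :- b) ≈-refl (Σ< L g) (g L))
                              (⊕-congʳ (negF (g L)) (Σ<-negF L))

Σ<-sucˡ : ∀ L (f : ℕ → FPS) → Σ< (suc L) f ≈ f 0 ⊕ Σ< L (f ∘ suc)
Σ<-sucˡ zero f = mk≈ λ k → ℤP.+-comm 0ℤ (f 0 k)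
Σ<-sucˡ (suc L) f = ≈-trans (⊕-congʳ (f (suc L)) (Σ<-sucˡ L f))
  (solve 3 (λ a b c → (a :+ b) :+ c := a :+ (b :+ c)) ≈-refl (f 0) (Σ< L (f ∘ suc)) (f (suc L)))

Σ<-zero : ∀ L → Σ< L (λ _ → zeroF) ≈ zeroF
Σ<-zero zero = ≈-refl
Σ<-zero (suc L) = ≈-trans (⊕-congʳ zeroF (Σ<-zero L)) (mk≈ λ _ → refl)

Σ<-telescope : ∀ L (f : ℕ → FPS) → Σ< L (λ i → f (suc i) ⊖ f i) ≈ f L ⊖ f 0
Σ<-telescope zero f = mk≈ λ k → sym (ℤP.+-inverseʳ (f 0 k))
Σ<-telescope (suc L) f = ≈-trans (⊕-congʳ (f (suc L) ⊖ f L) (Σ<-telescope L f))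
  (solve 3 (λ a b c → (b :- a) :+ (c :- b) := c :- a) ≈-refl (f 0) (f L) (f (suc L)))

⊖≈0⇒≈ : ∀ {f g} → f ⊖ g ≈ zeroF → f ≈ g
⊖≈0⇒≈ {f} {g} e = begin
  f                ≈⟨ solve 2 (λ f g → f := (f :- g) :+ g) ≈-refl f g ⟩
  (f ⊖ g) ⊕ g      ≈⟨ ⊕-congʳ g e ⟩
  zeroF ⊕ g        ≈⟨ mk≈ (λ k → ℤP.+-identityˡ (g k)) ⟩
  g                ∎
  where open ≈-Reasoning

⊗-⊖-≈0 : ∀ {a b} k → a ≈ b → k ⊗ (a ⊖ b) ≈ zeroF
⊗-⊖-≈0 {a} {b} k a≈b = ≈-trans (⊗-congˡ k a-b≈0) (zeroʳ k)
  where
    a-b≈0 : a ⊖ b ≈ zeroF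
    a-b≈0 = mk≈ λ j → trans (cong (_+ - b j) (coeff a≈b j)) (ℤP.+-inverseʳ (b j))

-- The solver cannot use hypotheses; so L ≈ R is derived from known aᵢ ≈ bᵢ by checking the
-- polynomial identity L − R = Σᵢ kᵢ (aᵢ − bᵢ) with the solver.
byCombination₁ : ∀ {L R a₁ b₁} k₁ → a₁ ≈ b₁ → L ⊖ R ≈ k₁ ⊗ (a₁ ⊖ b₁) → L ≈ R
byCombination₁ k₁ h₁ e = ⊖≈0⇒≈ (≈-trans e (⊗-⊖-≈0 k₁ h₁))

byCombination₂ : ∀ {L R a₁ b₁ a₂ b₂} k₁ k₂ → a₁ ≈ b₁ → a₂ ≈ b₂ →
                 L ⊖ R ≈ (k₁ ⊗ (a₁ ⊖ b₁)) ⊕ (k₂ ⊗ (a₂ ⊖ b₂)) → L ≈ R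
byCombination₂ k₁ k₂ h₁ h₂ e =
  ⊖≈0⇒≈ (≈-trans e (≈-trans (+-cong (⊗-⊖-≈0 k₁ h₁) (⊗-⊖-≈0 k₂ h₂)) (mk≈ λ _ → refl)))

byCombination₃ : ∀ {L R a₁ b₁ a₂ b₂ a₃ b₃} k₁ k₂ k₃ → a₁ ≈ b₁ → a₂ ≈ b₂ → a₃ ≈ b₃ →
                 L ⊖ R ≈ ((k₁ ⊗ (a₁ ⊖ b₁)) ⊕ (k₂ ⊗ (a₂ ⊖ b₂))) ⊕ (k₃ ⊗ (a₃ ⊖ b₃)) → L ≈ R
byCombination₃ k₁ k₂ k₃ h₁ h₂ h₃ e = ⊖≈0⇒≈ (≈-trans e (≈-trans
  (+-cong (+-cong (⊗-⊖-≈0 k₁ h₁) (⊗-⊖-≈0 k₂ h₂)) (⊗-⊖-≈0 k₃ h₃)) (mk≈ λ _ → refl)))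

byCombination₄ : ∀ {L R a₁ b₁ a₂ b₂ a₃ b₃ a₄ b₄} k₁ k₂ k₃ k₄ → a₁ ≈ b₁ → a₂ ≈ b₂ → a₃ ≈ b₃ → a₄ ≈ b₄ →
                 L ⊖ R ≈ (((k₁ ⊗ (a₁ ⊖ b₁)) ⊕ (k₂ ⊗ (a₂ ⊖ b₂))) ⊕ (k₃ ⊗ (a₃ ⊖ b₃))) ⊕ (k₄ ⊗ (a₄ ⊖ b₄)) → L ≈ R
byCombination₄ k₁ k₂ k₃ k₄ h₁ h₂ h₃ h₄ e = ⊖≈0⇒≈ (≈-trans e (≈-trans
  (+-cong (+-cong (+-cong (⊗-⊖-≈0 k₁ h₁) (⊗-⊖-≈0 k₂ h₂)) (⊗-⊖-≈0 k₃ h₃)) (⊗-⊖-≈0 k₄ h₄)) (mk≈ λ _ → refl)))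

-- Gaussian binomial coefficients

𝟙 : ∀ {n} → Polynomial n
𝟙 = con 1ℤ

qbinom : ℕ → ℕ → FPS
qbinom N zero = one
qbinom zero (suc i) = zeroF
qbinom (suc N) (suc i) = qbinom N i ⊕ (qpow (suc i) ⊗ qbinom N (suc i))

qbinom-vanish : ∀ N i → N < i → qbinom N i ≈ zeroF
qbinom-vanish zero (suc i) _ = ≈-refl
qbinom-vanish (suc N) (suc i) (s≤s N<i) =
  ≈-trans (+-cong (qbinom-vanish N i N<i)
                  (≈-trans (⊗-congˡ (qpow (suc i)) (qbinom-vanish N (suc i) (ℕP.m≤n⇒m≤1+n N<i))) (zeroʳ (qpow (suc i)))))
          (mk≈ λ _ → refl)

⊗-qbinom-vanish : ∀ c N i → N < i → c ⊗ qbinom N i ≈ zeroF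
⊗-qbinom-vanish c N i N<i = ≈-trans (⊗-congˡ c (qbinom-vanish N i N<i)) (zeroʳ c)

qbinom-diag : ∀ N → qbinom N N ≈ one
qbinom-diag zero = ≈-refl
qbinom-diag (suc N) =
  ≈-trans (+-cong (qbinom-diag N) (⊗-qbinom-vanish (qpow (suc N)) N (suc N) (ℕP.n<1+n N)))
          (mk≈ λ k → ℤP.+-identityʳ (one k))

qbinom-pascal₂ : ∀ N i → qbinom (suc N) (suc i) ≈ (qpow (N ∸ i) ⊗ qbinom N i) ⊕ qbinom N (suc i)
qbinom-pascal₂ zero zero = mk≈ λ k → trans (cong (one k +_) (coeff (zeroʳ (qpow 1)) k))
  (trans (ℤP.+-identityʳ (one k)) (sym (trans (ℤP.+-identityʳ _) (⊗-identityˡ-≐ one k))))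
qbinom-pascal₂ zero (suc i) = ≈-trans (⊕-congˡ zeroF (zeroʳ (qpow (suc (suc i)))))
                                      (≈-sym (≈-trans (⊕-congʳ zeroF (zeroʳ (qpow 0))) (mk≈ λ _ → refl)))
qbinom-pascal₂ (suc N) zero = begin
    one ⊕ (qpow 1 ⊗ qbinom (suc N) 1)
      ≈⟨ ⊕-congˡ one (⊗-congˡ (qpow 1) (qbinom-pascal₂ N 0)) ⟩
    one ⊕ (qpow 1 ⊗ ((qpow N ⊗ one) ⊕ qbinom N 1))
      ≈⟨ solve 4 (λ o q qN b → o :+ q :* (qN :* o :+ b) := (q :* qN) :* o :+ (o :+ q :* b)) ≈-refl
           one (qpow 1) (qpow N) (qbinom N 1) ⟩
    ((qpow 1 ⊗ qpow N) ⊗ one) ⊕ (one ⊕ (qpow 1 ⊗ qbinom N 1))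
      ≈⟨ ⊕-congʳ (one ⊕ (qpow 1 ⊗ qbinom N 1)) (⊗-congʳ one (qpow-+ 1 N)) ⟩
    (qpow (suc N) ⊗ one) ⊕ qbinom (suc N) 1 ∎
  where open ≈-Reasoning
qbinom-pascal₂ (suc N) (suc j) = begin
    qbinom (suc N) (suc j) ⊕ (c ⊗ qbinom (suc N) (suc (suc j)))
      ≈⟨ +-cong (qbinom-pascal₂ N j) (⊗-congˡ c (qbinom-pascal₂ N (suc j))) ⟩
    ((a ⊗ b) ⊕ B) ⊕ (c ⊗ ((d ⊗ B) ⊕ C))
      ≈⟨ solve 6 (λ a b B c d C → (a :* b :+ B) :+ c :* (d :* B :+ C) := (a :* b :+ B :+ c :* C) :+ c :* (d :* B))
           ≈-refl a b B c d C ⟩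
    (((a ⊗ b) ⊕ B) ⊕ (c ⊗ C)) ⊕ (c ⊗ (d ⊗ B))
      ≈⟨ ⊕-congˡ (((a ⊗ b) ⊕ B) ⊕ (c ⊗ C)) exponents ⟩
    (((a ⊗ b) ⊕ B) ⊕ (c ⊗ C)) ⊕ (a ⊗ (e ⊗ B))
      ≈⟨ solve 6 (λ a b B c C e → (a :* b :+ B :+ c :* C) :+ a :* (e :* B) := a :* (b :+ e :* B) :+ (B :+ c :* C))
           ≈-refl a b B c C e ⟩
    (a ⊗ (b ⊕ (e ⊗ B))) ⊕ (B ⊕ (c ⊗ C)) ∎
  where
    open ≈-Reasoning
    a = qpow (N ∸ j)
    b = qbinom N j
    B = qbinom N (suc j)
    c = qpow (suc (suc j))
    d = qpow (N ∸ suc j)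
    e = qpow (suc j)
    C = qbinom N (suc (suc j))
    -- both sides are q^{N+1} B when j < N, and B vanishes otherwise
    exponents : c ⊗ (d ⊗ B) ≈ a ⊗ (e ⊗ B)
    exponents with suc j ≤? N
    ... | yes j<N = begin
        c ⊗ (d ⊗ B)           ≈⟨ ≈-sym (*-assoc c d B) ⟩
        (c ⊗ d) ⊗ B           ≈⟨ ⊗-congʳ B (qpow-+≡ (suc (suc j)) (N ∸ suc j) (cong suc (ℕP.m+[n∸m]≡n j<N))) ⟩
        qpow (suc N) ⊗ B      ≈⟨ ⊗-congʳ B (≈-sym (qpow-+≡ (N ∸ j) (suc j)
                                   (trans (ℕP.+-comm (N ∸ j) (suc j)) (cong suc (ℕP.m+[n∸m]≡n (ℕP.<⇒≤ j<N)))))) ⟩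
        (a ⊗ e) ⊗ B           ≈⟨ *-assoc a e B ⟩
        a ⊗ (e ⊗ B)           ∎
    ... | no j≮N = ≈-trans (⊗-congˡ c (⊗-qbinom-vanish d N (suc j) (ℕP.≰⇒> j≮N)))
                   (≈-trans (zeroʳ c) (≈-sym (≈-trans (⊗-congˡ a (⊗-qbinom-vanish e N (suc j) (ℕP.≰⇒> j≮N))) (zeroʳ a))))

qbinom-suc-ratio : ∀ N i → (one ⊖ qpow (suc i)) ⊗ qbinom N (suc i) ≈ (one ⊖ qpow (N ∸ i)) ⊗ qbinom N i
qbinom-suc-ratio N i = byCombination₁ (const -1ℤ) (qbinom-pascal₂ N i)
  (solve 4 (λ p r X Y → ((𝟙 :- p) :* Y) :- ((𝟙 :- r) :* X) := con -1ℤ :* ((X :+ (p :* Y)) :- ((r :* X) :+ Y)))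
     ≈-refl (qpow (suc i)) (qpow (N ∸ i)) (qbinom N i) (qbinom N (suc i)))

qbinom-top-ratio : ∀ M n → (one ⊖ qpow (suc M)) ⊗ qbinom M n ≈ (one ⊖ qpow (suc M ∸ n)) ⊗ qbinom (suc M) n
qbinom-top-ratio M zero = ≈-refl
qbinom-top-ratio M (suc i) with i ≤? M
... | yes i≤M = byCombination₃ (negF (one ⊖ r)) r Y (qbinom-pascal₂ M i) (qbinom-suc-ratio M i)
      (qpow-+≡ (M ∸ i) (suc i) (trans (ℕP.+-suc (M ∸ i) i) (cong suc (ℕP.m∸n+n≡m i≤M))))
      (solve 6 (λ p r Q X Y Z → ((𝟙 :- Q) :* Y) :- ((𝟙 :- r) :* Z)
                := (((:- (𝟙 :- r)) :* (Z :- ((r :* X) :+ Y))) :+ (r :* (((𝟙 :- p) :* Y) :- ((𝟙 :- r) :* X))))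
                   :+ (Y :* ((r :* p) :- Q)))
         ≈-refl (qpow (suc i)) r (qpow (suc M)) (qbinom M i) Y (qbinom (suc M) (suc i)))
  where
    r = qpow (M ∸ i)
    Y = qbinom M (suc i)
... | no i≰M = ≈-trans (⊗-qbinom-vanish (one ⊖ qpow (suc M)) M (suc i) (s≤s (ℕP.<⇒≤ (ℕP.≰⇒> i≰M))))
                       (≈-sym (⊗-qbinom-vanish (one ⊖ qpow (M ∸ i)) (suc M) (suc i) (s≤s (ℕP.≰⇒> i≰M))))

fallingPoch : ℕ → ℕ → FPS
fallingPoch N zero = one
fallingPoch N (suc i) = fallingPoch N i ⊗ (one ⊖ qpow (N ∸ i))

qbinom-⊗-qPoch : ∀ N i → qbinom N i ⊗ qPoch i ≈ fallingPoch N i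
qbinom-⊗-qPoch N zero = *-identityˡ one
qbinom-⊗-qPoch N (suc i) = byCombination₂ P (one ⊖ r) (qbinom-suc-ratio N i) (qbinom-⊗-qPoch N i)
  (solve 6 (λ p r X Y P F → (Y :* (P :* (𝟙 :- p))) :- (F :* (𝟙 :- r))
                            := (P :* (((𝟙 :- p) :* Y) :- ((𝟙 :- r) :* X))) :+ ((𝟙 :- r) :* ((X :* P) :- F)))
     ≈-refl (qpow (suc i)) r (qbinom N i) (qbinom N (suc i)) P (fallingPoch N i))
  where
    P = qPoch i
    r = qpow (N ∸ i)

risingPoch : ℕ → ℕ → FPS
risingPoch s zero = one
risingPoch s (suc b) = risingPoch s b ⊗ (one ⊖ qpow (s ℕ.+ b))

qbinom-⊗-qPoch-rising : ∀ a b → qbinom (b ℕ.+ a) a ⊗ qPoch b ≈ risingPoch (suc a) b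
qbinom-⊗-qPoch-rising a zero = ≈-trans (⊗-congʳ one (qbinom-diag a)) (*-identityˡ one)
qbinom-⊗-qPoch-rising a (suc b) = byCombination₂ (one ⊖ Q) (negF P) (qbinom-⊗-qPoch-rising a b) top-ratio
  (solve 6 (λ s Q X G P R → (G :* (P :* (𝟙 :- s))) :- (R :* (𝟙 :- Q))
                            := ((𝟙 :- Q) :* ((X :* P) :- R)) :+ ((:- P) :* (((𝟙 :- Q) :* X) :- ((𝟙 :- s) :* G))))
     ≈-refl (qpow (suc b)) Q (qbinom (b ℕ.+ a) a) (qbinom (suc (b ℕ.+ a)) a) P (risingPoch (suc a) b))
  where
    P = qPoch b
    Q = qpow (suc a ℕ.+ b)
    top-ratio : (one ⊖ Q) ⊗ qbinom (b ℕ.+ a) a ≈ (one ⊖ qpow (suc b)) ⊗ qbinom (suc (b ℕ.+ a)) a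
    top-ratio = subst₂ (λ x y → (one ⊖ qpow x) ⊗ qbinom (b ℕ.+ a) a ≈ (one ⊖ qpow y) ⊗ qbinom (suc (b ℕ.+ a)) a)
      (cong suc (ℕP.+-comm b a)) (trans (ℕP.+-∸-assoc 1 (ℕP.m≤n+m a b)) (cong suc (ℕP.m+n∸n≡m b a)))
      (qbinom-top-ratio (b ℕ.+ a) a)

1⊖qpow≡[]1 : ∀ s → one ⊖ qpow s ≡[ s ] one
1⊖qpow≡[]1 s j j<s = trans (cong (λ x → one j + - x) (q^∣qpow s j j<s)) (ℤP.+-identityʳ (one j))

fallingPoch≡[]1 : ∀ N n → n ≤ N → fallingPoch N n ≡[ suc N ∸ n ] one
fallingPoch≡[]1 N n n≤N = go n ℕP.≤-refl
  where
    go : ∀ i → i ≤ n → fallingPoch N i ≡[ suc N ∸ n ] one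
    go zero _ = ≡[]-refl
    go (suc i) i<n = ≡[]-trans
      (⊗-≡[] (go i (ℕP.<⇒≤ i<n)) (≡[]-weaken (ℕP.∸-monoʳ-≤ (suc N) i<n) (1⊖qpow≡[]1 (N ∸ i))))
      (≈⇒≡[] _ (*-identityˡ one))

risingPoch≡[]1 : ∀ s b → risingPoch s b ≡[ s ] one
risingPoch≡[]1 s zero = ≡[]-refl
risingPoch≡[]1 s (suc b) = ≡[]-trans
  (⊗-≡[] (risingPoch≡[]1 s b) (≡[]-weaken (ℕP.m≤m+n s b) (1⊖qpow≡[]1 (s ℕ.+ b))))
  (≈⇒≡[] _ (*-identityˡ one))

qPoch-+≡[] : ∀ j t → qPoch (t ℕ.+ j) ≡[ suc j ] qPoch j
qPoch-+≡[] j zero = ≡[]-refl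
qPoch-+≡[] j (suc t) = ≡[]-trans
  (⊗-≡[] (qPoch-+≡[] j t) (≡[]-weaken (s≤s (ℕP.m≤n+m j t)) (1⊖qpow≡[]1 (suc (t ℕ.+ j)))))
  (≈⇒≡[] _ (*-identityʳ (qPoch j)))

qPoch-coeff-zero : ∀ n → qPoch n 0 ≡ 1ℤ
qPoch-coeff-zero zero = refl
qPoch-coeff-zero (suc n) = trans (⊗-coeff-zero (qPoch n) (one ⊖ qpow (suc n))) (cong (_* 1ℤ) (qPoch-coeff-zero n))

Σ<-suc-vanish : ∀ L f → f L ≈ zeroF → Σ< (suc L) f ≈ Σ< L f
Σ<-suc-vanish L f fL≈0 = ≈-trans (⊕-congˡ (Σ< L f) fL≈0) (mk≈ λ k → ℤP.+-identityʳ (Σ< L f k))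

-- A finite form of the right-hand side

two : FPS
two = const (ℤ.+ 2)

𝟚 : ∀ {n} → Polynomial n
𝟚 = con (ℤ.+ 2)

-- For n = 0, 2/(1+q⁰) = 1 cannot be computed by inv, which needs constant term 1.
weight : ℕ → FPS
weight zero = one
weight (suc n) = two ⊗ inv (one ⊕ qpow (suc n))

weight-⊗-1⊕qpow : ∀ n → weight n ⊗ (one ⊕ qpow n) ≈ two
weight-⊗-1⊕qpow zero = solve 0 (𝟙 :* (𝟙 :+ 𝟙) := 𝟚) ≈-refl
weight-⊗-1⊕qpow (suc n) = byCombination₁ two (⊗-inverseʳ c refl)
  (solve 2 (λ c u → ((𝟚 :* u) :* c) :- 𝟚 := 𝟚 :* ((c :* u) :- 𝟙)) ≈-refl c (inv c))
  where c = one ⊕ qpow (suc n)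

const-neg : ∀ a → const (- a) ≈ negF (const a)
const-neg a = mk≈ λ { zero → refl ; (suc k) → refl }

rhsSummand : ℕ → FPS
rhsSummand n = (const (sgn n) ⊗ qpow (triangular (suc n))) ⊗ weight n

rhsFinite : ℕ → FPS
rhsFinite M = Σ< (suc M) (λ n → rhsSummand n ⊗ qbinom M n)

-- q-binomial theorem at x = -1: Σₙ (-1)ⁿ q^(n(n-1)/2) [N+1 n] = (1;q)_(N+1) = 0.
alternating-qbinom-sum : ∀ N → Σ< (suc (suc N)) (λ n → (const (sgn n) ⊗ qpow (triangular n)) ⊗ qbinom (suc N) n) ≈ zeroF
alternating-qbinom-sum N = begin
    Σ< (suc (suc N)) e                                ≈⟨ Σ<-sucˡ (suc N) e ⟩
    e 0 ⊕ Σ< (suc N) (e ∘ suc)                        ≈⟨ ⊕-congˡ (e 0) (Σ<-cong (suc N) (λ i _ → telescoping-step i)) ⟩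
    e 0 ⊕ Σ< (suc N) (λ i → u (suc i) ⊖ u i)          ≈⟨ ⊕-congˡ (e 0) (Σ<-telescope (suc N) u) ⟩
    e 0 ⊕ (u (suc N) ⊖ u 0)                           ≈⟨ ⊕-congˡ (e 0) (⊕-congʳ (negF (u 0)) (⊗-qbinom-vanish
                                                           (const (sgn (suc N)) ⊗ qpow (triangular (suc (suc N))))
                                                           N (suc N) (ℕP.n<1+n N))) ⟩
    e 0 ⊕ (zeroF ⊖ u 0)                               ≈⟨ mk≈ (λ k → cong (e 0 k +_) (ℤP.+-identityˡ (- u 0 k))) ⟩
    e 0 ⊕ negF (u 0)                                  ≈⟨ solve 0 (((𝟙 :* 𝟙) :* 𝟙) :+ (:- ((𝟙 :* 𝟙) :* 𝟙)) := con 0ℤ) ≈-refl ⟩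
    const 0ℤ                                          ≈⟨ mk≈ (λ { zero → refl ; (suc k) → refl }) ⟩
    zeroF                                             ∎
  where
    open ≈-Reasoning
    e : ℕ → FPS
    e n = (const (sgn n) ⊗ qpow (triangular n)) ⊗ qbinom (suc N) n
    u : ℕ → FPS
    u n = (const (sgn n) ⊗ qpow (triangular (suc n))) ⊗ qbinom N n
    telescoping-step : ∀ i → e (suc i) ≈ u (suc i) ⊖ u i
    telescoping-step i = byCombination₂ (t ⊗ X) (s′ ⊗ Y) (const-neg (sgn i)) (qpow-+ (triangular (suc i)) (suc i))
      (solve 7 (λ s s′ t t′ p X Y → ((s′ :* t) :* (X :+ (p :* Y))) :- (((s′ :* t′) :* Y) :- ((s :* t) :* X))
                                  := ((t :* X) :* (s′ :- (:- s))) :+ ((s′ :* Y) :* ((t :* p) :- t′)))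
         ≈-refl (const (sgn i)) s′ t (qpow (triangular (suc (suc i)))) (qpow (suc i)) X Y)
      where
        s′ = const (- sgn i)
        t = qpow (triangular (suc i))
        X = qbinom N i
        Y = qbinom N (suc i)

rhsFinite-suc-summand : ∀ M n → n ≤ suc M →
  ((one ⊕ qpow (suc M)) ⊗ (rhsSummand n ⊗ qbinom (suc M) n)) ⊖ ((one ⊖ qpow (suc M)) ⊗ (rhsSummand n ⊗ qbinom M n))
    ≈ (two ⊗ qpow (suc M)) ⊗ ((const (sgn n) ⊗ qpow (triangular n)) ⊗ qbinom (suc M) n)
rhsFinite-suc-summand M n n≤M+1 =
  byCombination₄ (negF ((s ⊗ t) ⊗ w)) (((s ⊗ t) ⊗ Z) ⊗ r) (negF (((s ⊗ t) ⊗ w) ⊗ Z) ⊕ (((two ⊗ s) ⊗ t′) ⊗ Z))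
                 ((two ⊗ s) ⊗ (Z ⊗ r))
    (qbinom-top-ratio M n) (weight-⊗-1⊕qpow n) (qpow-+≡ n (suc M ∸ n) (ℕP.m+[n∸m]≡n n≤M+1))
    (≈-sym (qpow-+ (triangular n) n))
    (solve 9 (λ s t w Z X Q r qⁿ t′ →
        (((𝟙 :+ Q) :* (((s :* t) :* w) :* Z)) :- ((𝟙 :- Q) :* (((s :* t) :* w) :* X))) :- ((𝟚 :* Q) :* ((s :* t′) :* Z))
      := ((((:- ((s :* t) :* w)) :* (((𝟙 :- Q) :* X) :- ((𝟙 :- r) :* Z)))
           :+ ((((s :* t) :* Z) :* r) :* ((w :* (𝟙 :+ qⁿ)) :- 𝟚)))
           :+ (((:- (((s :* t) :* w) :* Z)) :+ (((𝟚 :* s) :* t′) :* Z)) :* ((qⁿ :* r) :- Q)))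
           :+ (((𝟚 :* s) :* (Z :* r)) :* (t :- (t′ :* qⁿ))))
       ≈-refl s t w Z (qbinom M n) (qpow (suc M)) r (qpow n) t′)
  where
    s = const (sgn n)
    t = qpow (triangular (suc n))
    t′ = qpow (triangular n)
    w = weight n
    Z = qbinom (suc M) n
    r = qpow (suc M ∸ n)

rhsFinite-suc : ∀ M → (one ⊕ qpow (suc M)) ⊗ rhsFinite (suc M) ≈ (one ⊖ qpow (suc M)) ⊗ rhsFinite M
rhsFinite-suc M = ⊖≈0⇒≈ (begin
    (c ⊗ Σ< L F) ⊖ (d ⊗ rhsFinite M)
      ≈⟨ +-cong (⊗-Σ< L c F) (-‿cong (≈-trans (⊗-congˡ d (≈-sym extend)) (⊗-Σ< L d G))) ⟩
    Σ< L (λ n → c ⊗ F n) ⊖ Σ< L (λ n → d ⊗ G n)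
      ≈⟨ ≈-sym (Σ<-⊖ L (λ n → c ⊗ F n) (λ n → d ⊗ G n)) ⟩
    Σ< L (λ n → (c ⊗ F n) ⊖ (d ⊗ G n))
      ≈⟨ Σ<-cong L (λ n n<L → rhsFinite-suc-summand M n (ℕP.≤-pred n<L)) ⟩
    Σ< L (λ n → (two ⊗ qpow (suc M)) ⊗ e n)
      ≈⟨ ≈-sym (⊗-Σ< L (two ⊗ qpow (suc M)) e) ⟩
    (two ⊗ qpow (suc M)) ⊗ Σ< L e
      ≈⟨ ⊗-congˡ (two ⊗ qpow (suc M)) (alternating-qbinom-sum M) ⟩
    (two ⊗ qpow (suc M)) ⊗ zeroF
      ≈⟨ zeroʳ (two ⊗ qpow (suc M)) ⟩
    zeroF ∎)
  where
    open ≈-Reasoning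
    L = suc (suc M)
    c = one ⊕ qpow (suc M)
    d = one ⊖ qpow (suc M)
    F G e : ℕ → FPS
    F n = rhsSummand n ⊗ qbinom (suc M) n
    G n = rhsSummand n ⊗ qbinom M n
    e n = (const (sgn n) ⊗ qpow (triangular n)) ⊗ qbinom (suc M) n
    extend : Σ< L G ≈ rhsFinite M
    extend = Σ<-suc-vanish (suc M) G (⊗-qbinom-vanish (rhsSummand (suc M)) M (suc M) (ℕP.n<1+n M))

negPoch : ℕ → FPS
negPoch zero = one
negPoch (suc M) = negPoch M ⊗ (one ⊕ qpow (suc M))

rhsFinite-⊗-negPoch : ∀ M → rhsFinite M ⊗ negPoch M ≈ qPoch M
rhsFinite-⊗-negPoch zero = ≈-trans (⊗-congʳ one (mk≈ λ k → ℤP.+-identityˡ ((rhsSummand 0 ⊗ one) k)))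
                                   (solve 0 ((((𝟙 :* 𝟙) :* 𝟙) :* 𝟙) :* 𝟙 := 𝟙) ≈-refl)
rhsFinite-⊗-negPoch (suc M) = byCombination₂ (negPoch M) (one ⊖ Q) (rhsFinite-suc M) (rhsFinite-⊗-negPoch M)
  (solve 5 (λ T′ T N P Q → (T′ :* (N :* (𝟙 :+ Q))) :- (P :* (𝟙 :- Q))
                         := (N :* (((𝟙 :+ Q) :* T′) :- ((𝟙 :- Q) :* T))) :+ ((𝟙 :- Q) :* ((T :* N) :- P)))
     ≈-refl (rhsFinite (suc M)) (rhsFinite M) (negPoch M) (qPoch M) Q)
  where Q = qpow (suc M)

-- A finite form of Gauss's identity

gaussSummand : ℕ → ℕ → FPS
gaussSummand M i = const (sgn (i ℕ.+ M)) ⊗ qpow (sqDist M i)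

gaussFinite : ℕ → FPS
gaussFinite M = Σ< (suc (double M)) (λ i → gaussSummand M i ⊗ qbinom (double M) i)

oddPoch : ℕ → FPS
oddPoch zero = one
oddPoch (suc M) = oddPoch M ⊗ (one ⊖ qpow (suc (double M)))

Σ<-qbinom-pascal : ∀ N L (s : ℕ → FPS) → N < L →
  Σ< (suc L) (λ i → s i ⊗ qbinom (suc N) i) ≈ Σ< L (λ i → (s (suc i) ⊕ (s i ⊗ qpow i)) ⊗ qbinom N i)
Σ<-qbinom-pascal N L s N<L = begin
    Σ< (suc L) (λ i → s i ⊗ qbinom (suc N) i)
      ≈⟨ Σ<-sucˡ L (λ i → s i ⊗ qbinom (suc N) i) ⟩
    (s 0 ⊗ one) ⊕ Σ< L (λ i → s (suc i) ⊗ qbinom (suc N) (suc i))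
      ≈⟨ +-cong (solve 1 (λ a → a :* 𝟙 := (a :* 𝟙) :* 𝟙) ≈-refl (s 0)) (Σ<-cong L (λ i _ → split i)) ⟩
    v 0 ⊕ Σ< L (λ i → a i ⊕ v (suc i))
      ≈⟨ ⊕-congˡ (v 0) (Σ<-⊕ L a (v ∘ suc)) ⟩
    v 0 ⊕ (Σ< L a ⊕ Σ< L (v ∘ suc))
      ≈⟨ solve 3 (λ x y z → x :+ (y :+ z) := y :+ (x :+ z)) ≈-refl (v 0) (Σ< L a) (Σ< L (v ∘ suc)) ⟩
    Σ< L a ⊕ (v 0 ⊕ Σ< L (v ∘ suc))
      ≈⟨ ⊕-congˡ (Σ< L a) (≈-sym (Σ<-sucˡ L v)) ⟩
    Σ< L a ⊕ Σ< (suc L) v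
      ≈⟨ ⊕-congˡ (Σ< L a) (Σ<-suc-vanish L v (⊗-qbinom-vanish (s L ⊗ qpow L) N L N<L)) ⟩
    Σ< L a ⊕ Σ< L v
      ≈⟨ ≈-sym (Σ<-⊕ L a v) ⟩
    Σ< L (λ i → a i ⊕ v i)
      ≈⟨ Σ<-cong L (λ i _ → ≈-sym (mk≈ (⊗-distribʳ-≐ (s (suc i)) (s i ⊗ qpow i) (qbinom N i)))) ⟩
    Σ< L (λ i → (s (suc i) ⊕ (s i ⊗ qpow i)) ⊗ qbinom N i) ∎
  where
    open ≈-Reasoning
    v a : ℕ → FPS
    v i = (s i ⊗ qpow i) ⊗ qbinom N i
    a i = s (suc i) ⊗ qbinom N i
    split : ∀ i → s (suc i) ⊗ qbinom (suc N) (suc i) ≈ a i ⊕ v (suc i)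
    split i = solve 4 (λ x b p c → x :* (b :+ (p :* c)) := (x :* b) :+ ((x :* p) :* c))
                ≈-refl (s (suc i)) (qbinom N i) (qpow (suc i)) (qbinom N (suc i))

gaussSummand-suc-suc : ∀ M i → gaussSummand (suc M) (suc i) ≈ gaussSummand M i
gaussSummand-suc-suc M i = ⊗-congʳ (qpow (sqDist M i)) (const-cong (begin
    - sgn (i ℕ.+ suc M)    ≡⟨ cong (λ n → - sgn n) (ℕP.+-suc i M) ⟩
    - - sgn (i ℕ.+ M)      ≡⟨ ℤP.neg-involutive (sgn (i ℕ.+ M)) ⟩
    sgn (i ℕ.+ M)          ∎))
  where open ≡-Reasoning

gaussSummand-suc-⊗-qpow² : ∀ M m →
  (gaussSummand (suc M) m ⊗ qpow m) ⊗ qpow m ≈ negF (gaussSummand M m) ⊗ qpow (suc (double M))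
gaussSummand-suc-⊗-qpow² M m =
  byCombination₂ ((p₁ ⊗ qᵐ) ⊗ qᵐ) (negF σ) (≈-trans (const-cong (cong sgn (ℕP.+-suc m M))) (const-neg (sgn (m ℕ.+ M))))
                 exponents
    (solve 6 (λ s₁ σ p₁ p₀ qᵐ O → (((s₁ :* p₁) :* qᵐ) :* qᵐ) :- ((:- (σ :* p₀)) :* O)
                                := (((p₁ :* qᵐ) :* qᵐ) :* (s₁ :- (:- σ))) :+ ((:- σ) :* (((p₁ :* qᵐ) :* qᵐ) :- (p₀ :* O))))
       ≈-refl (const (sgn (m ℕ.+ suc M))) σ p₁ (qpow (sqDist M m)) qᵐ (qpow (suc (double M))))
  where
    σ = const (sgn (m ℕ.+ M))
    p₁ = qpow (sqDist (suc M) m)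
    qᵐ = qpow m
    exponents : (p₁ ⊗ qᵐ) ⊗ qᵐ ≈ qpow (sqDist M m) ⊗ qpow (suc (double M))
    exponents = ≈-trans (⊗-congʳ qᵐ (qpow-+ (sqDist (suc M) m) m))
      (≈-trans (qpow-+ (sqDist (suc M) m ℕ.+ m) m)
      (≈-trans (qpow-cong (sqDist-sucˡ M m)) (≈-sym (qpow-+ (sqDist M m) (suc (double M))))))

-- The two terms cancel: the signs are opposite and the exponents agree by sqDist-sucʳ.
gaussSummand-pair-vanish : ∀ M m → m ≤ double M →
  qbinom (double M) m ⊗ ((qpow (suc m) ⊗ gaussSummand M m) ⊕ (qpow (double M ∸ m) ⊗ gaussSummand M (suc m))) ≈ zeroF
gaussSummand-pair-vanish M m m≤2M = ≈-trans
  (byCombination₂ ((B ⊗ r) ⊗ p₁) (negF (B ⊗ σ)) (const-neg (sgn (m ℕ.+ M))) exponents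
    (solve 7 (λ B qᵐ⁺¹ σ σ′ p₀ r p₁ → (B :* ((qᵐ⁺¹ :* (σ :* p₀)) :+ (r :* (σ′ :* p₁)))) :- con 0ℤ
                                    := (((B :* r) :* p₁) :* (σ′ :- (:- σ))) :+ ((:- (B :* σ)) :* ((r :* p₁) :- (qᵐ⁺¹ :* p₀))))
       ≈-refl B (qpow (suc m)) σ (const (- sgn (m ℕ.+ M))) (qpow (sqDist M m)) r p₁))
  (mk≈ λ { zero → refl ; (suc k) → refl })
  where
    B = qbinom (double M) m
    σ = const (sgn (m ℕ.+ M))
    r = qpow (double M ∸ m)
    p₁ = qpow (sqDist M (suc m))
    exponents : r ⊗ p₁ ≈ qpow (suc m) ⊗ qpow (sqDist M m)
    exponents = ≈-trans (qpow-+ (double M ∸ m) (sqDist M (suc m)))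
      (≈-trans (qpow-cong (sqDist-sucʳ M m m≤2M)) (≈-sym (qpow-+ (suc m) (sqDist M m))))

module _ (M : ℕ) where
  private
    s Y B : ℕ → FPS
    s = gaussSummand (suc M)
    Y = gaussSummand M
    B = qbinom (double M)
    O : FPS
    O = qpow (suc (double M))

    pascal² : ℕ → FPS
    pascal² m = (s (suc (suc m)) ⊕ (s (suc m) ⊗ qpow (suc m))) ⊕ ((s (suc m) ⊕ (s m ⊗ qpow m)) ⊗ qpow m)

    pair : ℕ → FPS
    pair m = B m ⊗ ((qpow (suc m) ⊗ Y m) ⊕ (qpow (double M ∸ m) ⊗ Y (suc m)))

    boundary : ℕ → FPS
    boundary m = ((one ⊖ qpow m) ⊗ Y m) ⊗ B m

    pascal²-summand : ∀ m → (pascal² m ⊗ B m) ⊖ ((one ⊖ O) ⊗ (Y m ⊗ B m)) ≈ pair m ⊕ (boundary (suc m) ⊖ boundary m)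
    pascal²-summand m = byCombination₄ (B m) ((qpow (suc m) ⊕ qpow m) ⊗ B m) (B m) (negF (Y (suc m)))
      (gaussSummand-suc-suc M (suc m)) (gaussSummand-suc-suc M m) (gaussSummand-suc-⊗-qpow² M m)
      (qbinom-suc-ratio (double M) m)
      (solve 11 (λ s₀ s₁ s₂ Y₀ Y₁ B₀ B₁ qᵐ qᵐ⁺¹ O r →
         ((((s₂ :+ (s₁ :* qᵐ⁺¹)) :+ ((s₁ :+ (s₀ :* qᵐ)) :* qᵐ)) :* B₀) :- ((𝟙 :- O) :* (Y₀ :* B₀)))
         :- ((B₀ :* ((qᵐ⁺¹ :* Y₀) :+ (r :* Y₁))) :+ ((((𝟙 :- qᵐ⁺¹) :* Y₁) :* B₁) :- (((𝟙 :- qᵐ) :* Y₀) :* B₀)))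
        := (((B₀ :* (s₂ :- Y₁)) :+ (((qᵐ⁺¹ :+ qᵐ) :* B₀) :* (s₁ :- Y₀))) :+ (B₀ :* (((s₀ :* qᵐ) :* qᵐ) :- ((:- Y₀) :* O))))
           :+ ((:- Y₁) :* (((𝟙 :- qᵐ⁺¹) :* B₁) :- ((𝟙 :- r) :* B₀))))
        ≈-refl (s m) (s (suc m)) (s (suc (suc m))) (Y m) (Y (suc m)) (B m) (B (suc m))
               (qpow m) (qpow (suc m)) O (qpow (double M ∸ m)))

  gaussFinite-suc : gaussFinite (suc M) ≈ (one ⊖ qpow (suc (double M))) ⊗ gaussFinite M
  gaussFinite-suc = begin
      gaussFinite (suc M)
        ≈⟨ Σ<-qbinom-pascal (suc (double M)) (suc (suc (double M))) s (ℕP.n<1+n _) ⟩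
      Σ< (suc (suc (double M))) (λ i → (s (suc i) ⊕ (s i ⊗ qpow i)) ⊗ qbinom (suc (double M)) i)
        ≈⟨ Σ<-qbinom-pascal (double M) L (λ i → s (suc i) ⊕ (s i ⊗ qpow i)) (ℕP.n<1+n _) ⟩
      Σ< L (λ m → pascal² m ⊗ B m)
        ≈⟨ ⊖≈0⇒≈ telescoped ⟩
      (one ⊖ O) ⊗ gaussFinite M ∎
    where
      open ≈-Reasoning
      L = suc (double M)
      telescoped : Σ< L (λ m → pascal² m ⊗ B m) ⊖ ((one ⊖ O) ⊗ gaussFinite M) ≈ zeroF
      telescoped = begin
          Σ< L (λ m → pascal² m ⊗ B m) ⊖ ((one ⊖ O) ⊗ gaussFinite M)
            ≈⟨ ⊕-congˡ (Σ< L (λ m → pascal² m ⊗ B m)) (-‿cong (⊗-Σ< L (one ⊖ O) (λ m → Y m ⊗ B m))) ⟩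
          Σ< L (λ m → pascal² m ⊗ B m) ⊖ Σ< L (λ m → (one ⊖ O) ⊗ (Y m ⊗ B m))
            ≈⟨ ≈-sym (Σ<-⊖ L (λ m → pascal² m ⊗ B m) (λ m → (one ⊖ O) ⊗ (Y m ⊗ B m))) ⟩
          Σ< L (λ m → (pascal² m ⊗ B m) ⊖ ((one ⊖ O) ⊗ (Y m ⊗ B m)))
            ≈⟨ Σ<-cong L (λ m _ → pascal²-summand m) ⟩
          Σ< L (λ m → pair m ⊕ (boundary (suc m) ⊖ boundary m))
            ≈⟨ Σ<-⊕ L pair (λ m → boundary (suc m) ⊖ boundary m) ⟩
          Σ< L pair ⊕ Σ< L (λ m → boundary (suc m) ⊖ boundary m)
            ≈⟨ +-cong (≈-trans (Σ<-cong L (λ m m<L → gaussSummand-pair-vanish M m (ℕP.≤-pred m<L))) (Σ<-zero L))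
                      (Σ<-telescope L boundary) ⟩
          zeroF ⊕ (boundary L ⊖ boundary 0)
            ≈⟨ ⊕-congˡ zeroF (+-cong (⊗-qbinom-vanish ((one ⊖ qpow L) ⊗ Y L) (double M) L (ℕP.n<1+n (double M)))
                                     (-‿cong boundary₀)) ⟩
          zeroF ⊕ (zeroF ⊕ negF zeroF)
            ≈⟨ mk≈ (λ _ → refl) ⟩
          zeroF ∎
        where
          boundary₀ : boundary 0 ≈ zeroF
          boundary₀ = ≈-trans (solve 1 (λ y → ((𝟙 :- 𝟙) :* y) :* 𝟙 := con 0ℤ) ≈-refl (Y 0))
                              (mk≈ λ { zero → refl ; (suc k) → refl })

gaussFinite≈oddPoch : ∀ M → gaussFinite M ≈ oddPoch M
gaussFinite≈oddPoch zero = ≈-trans (mk≈ λ k → ℤP.+-identityˡ ((gaussSummand 0 0 ⊗ one) k))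
                                   (solve 0 ((𝟙 :* 𝟙) :* 𝟙 := 𝟙) ≈-refl)
gaussFinite≈oddPoch (suc M) = ≈-trans (gaussFinite-suc M)
  (≈-trans (⊗-congˡ (one ⊖ qpow (suc (double M))) (gaussFinite≈oddPoch M)) (*-comm (one ⊖ qpow (suc (double M))) (oddPoch M)))

oddPoch-⊗-negPoch-⊗-qPoch : ∀ M → (oddPoch M ⊗ negPoch M) ⊗ qPoch M ≈ qPoch (double M)
oddPoch-⊗-negPoch-⊗-qPoch zero = solve 0 ((𝟙 :* 𝟙) :* 𝟙 := 𝟙) ≈-refl
oddPoch-⊗-negPoch-⊗-qPoch (suc M) =
  byCombination₂ ((one ⊖ a) ⊗ (one ⊖ (b ⊗ b))) (negF ((one ⊖ a) ⊗ P₂)) (oddPoch-⊗-negPoch-⊗-qPoch M)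
    (qpow-+≡ (suc M) (suc M) (trans (cong suc (ℕP.+-suc M M)) (cong (suc ∘ suc) (sym (double≡+ M)))))
    (solve 7 (λ O N P P₂ a b c → (((O :* (𝟙 :- a)) :* (N :* (𝟙 :+ b))) :* (P :* (𝟙 :- b))) :- ((P₂ :* (𝟙 :- a)) :* (𝟙 :- c))
                               := (((𝟙 :- a) :* (𝟙 :- (b :* b))) :* (((O :* N) :* P) :- P₂)) :+ ((:- ((𝟙 :- a) :* P₂)) :* ((b :* b) :- c)))
       ≈-refl (oddPoch M) (negPoch M) (qPoch M) P₂ a b (qpow (suc (suc (double M)))))
  where
    a = qpow (suc (double M))
    b = qpow (suc M)
    P₂ = qPoch (double M)

rhsFinite-⊗-qPoch-double : ∀ M → rhsFinite M ⊗ qPoch (double M) ≈ (gaussFinite M ⊗ qPoch M) ⊗ qPoch M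
rhsFinite-⊗-qPoch-double M =
  byCombination₃ (oddPoch M ⊗ qPoch M) (negF (rhsFinite M)) (negF (qPoch M ⊗ qPoch M))
    (rhsFinite-⊗-negPoch M) (oddPoch-⊗-negPoch-⊗-qPoch M) (gaussFinite≈oddPoch M)
    (solve 6 (λ T N P P₂ G O → (T :* P₂) :- ((G :* P) :* P)
                             := (((O :* P) :* ((T :* N) :- P)) :+ ((:- T) :* (((O :* N) :* P) :- P₂))) :+ ((:- (P :* P)) :* (G :- O)))
       ≈-refl (rhsFinite M) (negPoch M) (qPoch M) (qPoch (double M)) (gaussFinite M) (oddPoch M))

-- Truncation to the partial sums

two⊗inv-⊗-cancelˡ : ∀ P c → P 0 ≡ 1ℤ → c 0 ≡ 1ℤ → (two ⊗ inv (P ⊗ c)) ⊗ P ≈ two ⊗ inv c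
two⊗inv-⊗-cancelˡ P c P0≡1 c0≡1 = byCombination₂ (two ⊗ inv c) (negF ((two ⊗ inv (P ⊗ c)) ⊗ P))
  (⊗-inverseʳ (P ⊗ c) (trans (⊗-coeff-zero P c) (cong₂ _*_ P0≡1 c0≡1))) (⊗-inverseʳ c c0≡1)
  (solve 4 (λ P c u v → ((𝟚 :* u) :* P) :- (𝟚 :* v) := ((𝟚 :* v) :* (((P :* c) :* u) :- 𝟙)) :+ ((:- ((𝟚 :* u) :* P)) :* ((c :* v) :- 𝟙)))
     ≈-refl P c (inv (P ⊗ c)) (inv c))

rhsSummand≡[]rhsTerm : ∀ M n → suc n ≤ M → rhsSummand (suc n) ⊗ qbinom M (suc n) ≡[ suc M ] two ⊗ rhsTerm (suc n)
rhsSummand≡[]rhsTerm M n N≤M = ≡[]-trans (≈⇒≡[] (suc M) (*-assoc A (two ⊗ inv c) (qbinom M N)))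
  (≡[]-trans (⊗-≡[]-q^∣ {N} {suc M} {A} qᴺ∣A truncated) (≈⇒≡[] (suc M) (≈-sym factored)))
  where
    N = suc n
    A = const (sgn N) ⊗ qpow (triangular (suc N))
    c = one ⊕ qpow N
    P = qPoch N
    qᴺ∣A : q^ N ∣ A
    qᴺ∣A = ≡[]-weaken (ℕP.m≤n+m N (triangular N))
      (q^∣-⊗ˡ (triangular (suc N)) (const (sgn N)) (qpow (triangular (suc N))) (q^∣qpow (triangular (suc N))))
    factored : two ⊗ rhsTerm N ≈ A ⊗ (two ⊗ inv (P ⊗ c))
    factored = ≈-trans (⊗-congˡ two (⊗-congʳ (inv (P ⊗ c))
        (≈-trans (mk≈ λ k → cong (λ x → (sgn N · qpow x) k) (triangular-suc N))
                 (≈-sym (mk≈ (const-⊗ (sgn N) (qpow (triangular (suc N)))))))))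
      (solve 3 (λ A u t → t :* (A :* u) := A :* (t :* u)) ≈-refl A (inv (P ⊗ c)) two)
    -- [M N] (q;q)_N = (q^(M-N+1);q)_N ≡ 1 mod q^(M+1-N), so [M N] ≡ 1/(q;q)_N there.
    truncated : (two ⊗ inv c) ⊗ qbinom M N ≡[ suc M ∸ N ] two ⊗ inv (P ⊗ c)
    truncated = ⊗-cancelʳ-≡[] {c = P} (qPoch-coeff-zero N)
      (≡[]-trans (≈⇒≡[] _ (≈-trans (*-assoc (two ⊗ inv c) (qbinom M N) P) (⊗-congˡ (two ⊗ inv c) (qbinom-⊗-qPoch M N))))
      (≡[]-trans (⊗-≡[] {f = two ⊗ inv c} ≡[]-refl (fallingPoch≡[]1 M N N≤M))
      (≈⇒≡[] _ (≈-trans (*-identityʳ (two ⊗ inv c)) (≈-sym (two⊗inv-⊗-cancelˡ P c (qPoch-coeff-zero N) refl))))))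

rhsFinite-partial≡[] : ∀ M L → L ≤ M →
  Σ< (suc L) (λ n → rhsSummand n ⊗ qbinom M n) ≡[ suc M ] one ⊕ (two ⊗ sumTo L rhsTerm)
rhsFinite-partial≡[] M zero _ = ≈⇒≡[] (suc M) (≈-trans (mk≈ λ k → ℤP.+-identityˡ ((rhsSummand 0 ⊗ one) k))
  (≈-trans (solve 0 ((((𝟙 :* 𝟙) :* 𝟙) :* 𝟙) := 𝟙) ≈-refl)
           (≈-sym (≈-trans (⊕-congˡ one (zeroʳ two)) (mk≈ λ k → ℤP.+-identityʳ (one k))))))
rhsFinite-partial≡[] M (suc L) L<M = ≡[]-trans
  (⊕-≡[] (rhsFinite-partial≡[] M L (ℕP.<⇒≤ L<M)) (rhsSummand≡[]rhsTerm M L L<M))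
  (≈⇒≡[] (suc M) (solve 3 (λ S r t → (𝟙 :+ (t :* S)) :+ (t :* r) := 𝟙 :+ (t :* (S :+ r)))
                    ≈-refl (sumTo L rhsTerm) (rhsTerm (suc L)) two))

Σ<-gaussSummand : ∀ M → Σ< (suc (double M)) (gaussSummand M) ≈ one ⊕ (two ⊗ sumTo M lhsTerm)
Σ<-gaussSummand zero = ≈-trans (mk≈ λ k → ℤP.+-identityˡ (gaussSummand 0 0 k))
  (≈-trans (solve 0 (𝟙 :* 𝟙 := 𝟙) ≈-refl) (≈-sym (≈-trans (⊕-congˡ one (zeroʳ two)) (mk≈ λ k → ℤP.+-identityʳ (one k)))))
Σ<-gaussSummand (suc M) = begin
    Σ< (suc (suc (double M))) (gaussSummand (suc M)) ⊕ gaussSummand (suc M) (double (suc M))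
      ≈⟨ ⊕-congʳ (gaussSummand (suc M) (double (suc M))) (Σ<-sucˡ (suc (double M)) (gaussSummand (suc M))) ⟩
    (gaussSummand (suc M) 0 ⊕ Σ< (suc (double M)) (λ i → gaussSummand (suc M) (suc i))) ⊕ gaussSummand (suc M) (double (suc M))
      ≈⟨ +-cong (+-cong first (≈-trans (Σ<-cong (suc (double M)) (λ i _ → gaussSummand-suc-suc M i)) (Σ<-gaussSummand M))) last ⟩
    (l ⊕ (one ⊕ (two ⊗ S))) ⊕ l
      ≈⟨ solve 3 (λ l S t → (l :+ (𝟙 :+ (𝟚 :* S))) :+ l := 𝟙 :+ (𝟚 :* (S :+ l))) ≈-refl l S two ⟩
    one ⊕ (two ⊗ (S ⊕ l))
      ≈⟨ ⊕-congˡ one (⊗-congˡ two (⊕-congˡ S (mk≈ (const-⊗ (sgn (suc M)) (qpow (suc M ℕ.* suc M)))))) ⟩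
    one ⊕ (two ⊗ sumTo (suc M) lhsTerm) ∎
  where
    open ≈-Reasoning
    S = sumTo M lhsTerm
    l = const (sgn (suc M)) ⊗ qpow (suc M ℕ.* suc M)
    first : gaussSummand (suc M) 0 ≈ l
    first = ⊗-congˡ (const (sgn (suc M))) (qpow-cong (ℕP.+-identityʳ (suc M ℕ.* suc M)))
    last : gaussSummand (suc M) (double (suc M)) ≈ l
    last = *-cong (const-cong (sgn-double+ (suc M) (suc M)))
                  (qpow-cong (trans (cong (sqDist (suc M)) (double≡+ (suc M))) (sqDist-+ʳ (suc M) (suc M))))

qbinom-double-⊗-qPoch≡[]1-≤ : ∀ M i → i ≤ M → qbinom (double M) i ⊗ qPoch M ≡[ suc i ] one
qbinom-double-⊗-qPoch≡[]1-≤ M i i≤M =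
  ≡[]-trans (⊗-≡[] {f = qbinom (double M) i} ≡[]-refl qPoch-M≡qPoch-i)
  (≡[]-trans (≈⇒≡[] _ (qbinom-⊗-qPoch (double M) i)) (≡[]-weaken i<2M+1-i (fallingPoch≡[]1 (double M) i i≤2M)))
  where
    i≤2M : i ≤ double M
    i≤2M = subst (i ≤_) (sym (double≡+ M)) (ℕP.≤-trans i≤M (ℕP.m≤m+n M M))
    qPoch-M≡qPoch-i : qPoch M ≡[ suc i ] qPoch i
    qPoch-M≡qPoch-i = subst (λ X → qPoch X ≡[ suc i ] qPoch i) (ℕP.m∸n+n≡m i≤M) (qPoch-+≡[] i (M ∸ i))
    i<2M+1-i : suc i ≤ suc (double M) ∸ i
    i<2M+1-i = subst (suc i ≤_)
      (sym (trans (ℕP.+-∸-assoc 1 i≤2M) (cong suc (trans (cong (_∸ i) (double≡+ M)) (ℕP.+-∸-assoc M i≤M)))))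
      (s≤s (ℕP.≤-trans i≤M (ℕP.m≤m+n M (M ∸ i))))

-- Writing i = M + t, the complement b = M − t satisfies b + i = 2M, so [2M i] (q;q)_b is a rising product.
qbinom-double-⊗-qPoch≡[]1-≥ : ∀ M i → M ≤ i → i ≤ double M → qbinom (double M) i ⊗ qPoch M ≡[ suc (M ∸ (i ∸ M)) ] one
qbinom-double-⊗-qPoch≡[]1-≥ M i M≤i i≤2M =
  ≡[]-trans (⊗-≡[] {f = qbinom (double M) i} ≡[]-refl qPoch-M≡qPoch-b)
  (≡[]-trans (≈⇒≡[] _ rising) (≡[]-weaken (s≤s b≤i) (risingPoch≡[]1 (suc i) b)))
  where
    t = i ∸ M
    b = M ∸ t
    M+t≡i : M ℕ.+ t ≡ i
    M+t≡i = ℕP.m+[n∸m]≡n M≤i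
    t≤M : t ≤ M
    t≤M = ℕP.+-cancelˡ-≤ M t M (subst₂ _≤_ (sym M+t≡i) (double≡+ M) i≤2M)
    t+b≡M : t ℕ.+ b ≡ M
    t+b≡M = ℕP.m+[n∸m]≡n t≤M
    b+i≡2M : b ℕ.+ i ≡ double M
    b+i≡2M = begin
        b ℕ.+ i              ≡⟨ cong (b ℕ.+_) (trans (sym M+t≡i) (ℕP.+-comm M t)) ⟩
        b ℕ.+ (t ℕ.+ M)      ≡⟨ sym (ℕP.+-assoc b t M) ⟩
        (b ℕ.+ t) ℕ.+ M      ≡⟨ cong (ℕ._+ M) (trans (ℕP.+-comm b t) t+b≡M) ⟩
        M ℕ.+ M              ≡⟨ sym (double≡+ M) ⟩
        double M             ∎
      where open ≡-Reasoning
    b≤i : b ≤ i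
    b≤i = ℕP.≤-trans (ℕP.m∸n≤m M t) M≤i
    qPoch-M≡qPoch-b : qPoch M ≡[ suc b ] qPoch b
    qPoch-M≡qPoch-b = subst (λ X → qPoch X ≡[ suc b ] qPoch b) t+b≡M (qPoch-+≡[] b t)
    rising : qbinom (double M) i ⊗ qPoch b ≈ risingPoch (suc i) b
    rising = subst (λ X → qbinom X i ⊗ qPoch b ≈ risingPoch (suc i) b) b+i≡2M (qbinom-⊗-qPoch-rising i b)

qbinom-double-⊗-qPoch≡[]1 : ∀ M i → i ≤ double M → qbinom (double M) i ⊗ qPoch M ≡[ suc M ∸ ((M ∸ i) ℕ.+ (i ∸ M)) ] one
qbinom-double-⊗-qPoch≡[]1 M i i≤2M with i ≤? M
... | yes i≤M = ≡[]-weaken (ℕP.≤-reflexive precision) (qbinom-double-⊗-qPoch≡[]1-≤ M i i≤M)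
  where
    precision : suc M ∸ ((M ∸ i) ℕ.+ (i ∸ M)) ≡ suc i
    precision = begin
      suc M ∸ ((M ∸ i) ℕ.+ (i ∸ M))  ≡⟨ cong (λ x → suc M ∸ ((M ∸ i) ℕ.+ x)) (ℕP.m≤n⇒m∸n≡0 i≤M) ⟩
      suc M ∸ ((M ∸ i) ℕ.+ 0)        ≡⟨ cong (suc M ∸_) (ℕP.+-identityʳ (M ∸ i)) ⟩
      suc M ∸ (M ∸ i)                ≡⟨ ℕP.+-∸-assoc 1 (ℕP.m∸n≤m M i) ⟩
      suc (M ∸ (M ∸ i))              ≡⟨ cong suc (ℕP.m∸[m∸n]≡n i≤M) ⟩
      suc i                          ∎
      where open ≡-Reasoning
... | no i≰M = ≡[]-weaken (ℕP.≤-reflexive precision) (qbinom-double-⊗-qPoch≡[]1-≥ M i M≤i i≤2M)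
  where
    M≤i : M ≤ i
    M≤i = ℕP.<⇒≤ (ℕP.≰⇒> i≰M)
    precision : suc M ∸ ((M ∸ i) ℕ.+ (i ∸ M)) ≡ suc (M ∸ (i ∸ M))
    precision = trans (cong (λ x → suc M ∸ (x ℕ.+ (i ∸ M))) (ℕP.m≤n⇒m∸n≡0 M≤i))
      (ℕP.+-∸-assoc 1 (ℕP.+-cancelˡ-≤ M (i ∸ M) M (subst₂ _≤_ (sym (ℕP.m+[n∸m]≡n M≤i)) (double≡+ M) i≤2M)))

n≤n*n : ∀ n → n ≤ n ℕ.* n
n≤n*n zero = z≤n
n≤n*n (suc n) = ℕP.m≤m*n (suc n) (suc n)

gaussSummand-⊗-qPoch≡[] : ∀ M i → i ≤ double M →
  gaussSummand M i ⊗ (qbinom (double M) i ⊗ qPoch M) ≡[ suc M ] gaussSummand M i ⊗ one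
gaussSummand-⊗-qPoch≡[] M i i≤2M = ⊗-≡[]-q^∣ {(M ∸ i) ℕ.+ (i ∸ M)} {suc M} {gaussSummand M i} divisible
  (qbinom-double-⊗-qPoch≡[]1 M i i≤2M)
  where
    divisible : q^ ((M ∸ i) ℕ.+ (i ∸ M)) ∣ gaussSummand M i
    divisible = ≡[]-weaken (ℕP.+-mono-≤ (n≤n*n (M ∸ i)) (n≤n*n (i ∸ M)))
      (q^∣-⊗ˡ (sqDist M i) (const (sgn (i ℕ.+ M))) (qpow (sqDist M i)) (q^∣qpow (sqDist M i)))

gaussFinite-⊗-qPoch≡[] : ∀ M → gaussFinite M ⊗ qPoch M ≡[ suc M ] one ⊕ (two ⊗ sumTo M lhsTerm)
gaussFinite-⊗-qPoch≡[] M = ≡[]-trans (≈⇒≡[] (suc M) distribute)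
  (≡[]-trans (Σ<-≡[] L (λ i i<L → gaussSummand-⊗-qPoch≡[] M i (ℕP.≤-pred i<L)))
  (≈⇒≡[] (suc M) (≈-trans (Σ<-cong L (λ i _ → *-identityʳ (gaussSummand M i))) (Σ<-gaussSummand M))))
  where
    L = suc (double M)
    P = qPoch M
    distribute : gaussFinite M ⊗ P ≈ Σ< L (λ i → gaussSummand M i ⊗ (qbinom (double M) i ⊗ P))
    distribute = ≈-trans (*-comm (gaussFinite M) P) (≈-trans (⊗-Σ< L P (λ i → gaussSummand M i ⊗ qbinom (double M) i))
      (Σ<-cong L (λ i _ → solve 3 (λ p w b → p :* (w :* b) := w :* (b :* p)) ≈-refl P (gaussSummand M i) (qbinom (double M) i))))

partialSums≡[] : ∀ M → one ⊕ (two ⊗ sumTo M rhsTerm) ≡[ suc M ] one ⊕ (two ⊗ sumTo M lhsTerm)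
partialSums≡[] M = ⊗-cancelʳ-≡[] {c = qPoch M} (qPoch-coeff-zero M)
  (≡[]-trans (⊗-≡[] {g = qPoch M} (≡[]-sym (rhsFinite-partial≡[] M M ℕP.≤-refl)) ≡[]-refl)
  (≡[]-trans (⊗-≡[] {f = rhsFinite M} ≡[]-refl (≡[]-sym qPoch-double≡qPoch))
  (≡[]-trans (≈⇒≡[] (suc M) (rhsFinite-⊗-qPoch-double M)) (⊗-≡[] {g = qPoch M} (gaussFinite-⊗-qPoch≡[] M) ≡[]-refl))))
  where
    qPoch-double≡qPoch : qPoch (double M) ≡[ suc M ] qPoch M
    qPoch-double≡qPoch = subst (λ X → qPoch X ≡[ suc M ] qPoch M) (sym (double≡+ M)) (qPoch-+≡[] M M)

1⊕two⊗-injective : ∀ (x y : FPS) k → (one ⊕ (two ⊗ x)) k ≡ (one ⊕ (two ⊗ y)) k → x k ≡ y k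
1⊕two⊗-injective x y k eq = ℤP.*-cancelˡ-≡ (ℤ.+ 2) (x k) (y k)
  (trans (sym (const-⊗ (ℤ.+ 2) x k)) (trans (∙-cancelˡ (one k) _ _ eq) (const-⊗ (ℤ.+ 2) y k)))

corollary2p2 : ∀ (k : ℕ) → ∃[ N ] ∀ (M : ℕ) → N ≤ M →
    sumTo M rhsTerm k ≡ sumTo M lhsTerm k
corollary2p2 k = k , λ M k≤M → 1⊕two⊗-injective (sumTo M rhsTerm) (sumTo M lhsTerm) k (partialSums≡[] M k (s≤s k≤M))
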